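{- $\widehat{\mathsf{WF}}\equiv_{sW}\mathsf S_{\vec L}$.
   Context: $\equiv_{sW}$ denotes strong Weihrauch equivalence. $\widehat{\mathsf{WF}}$: given a sequence $\langle T_i\rangle_{i\in\mathbb N}$ of trees $T_i\subseteq\mathbb N^{<\mathbb N}$, output $w:\mathbb N\to 2$ with $w(i)=0$ if $T_i$ contains an infinite path and $w(i)=1$ otherwise. $L$ is the linear graph with vertices $\{v_i:i\in\mathbb N\}$ and edges $\{(v_i,v_{i+1})\}$; for $n\in\mathbb N$, $L_n$ is $L$ with a cycle of size $n+3$ appended to the first vertex $v_0$ (e.g. $L_0$ is $L$ with a triangle attached at $v_0$). $\mathsf S_{\vec L}$: given a graph $G$, output $s:\mathbb N\to 2$ such that $s(n)=1$ iff $L_n$ is isomorphic to a subgraph of $G$. -}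

module Defs where

open import Data.Nat using (ℕ; zero; suc; _+_; _<_; _≤_)
open import Data.Fin using (Fin; inject₁; fromℕ)
open import Data.Vec using (Vec; []; _∷_)
open import Data.List using (List; []; _∷_; _++_; map; upTo)
open import Data.Product using (Σ; _×_; ∃)
open import Data.Sum using (_⊎_; inj₁; inj₂)
open import Relation.Nullary using (¬_)
open import Relation.Binary.PropositionalEquality using (_≡_)
open import Function.Definitions using (Injective)

Baire : Set
Baire = ℕ → ℕ

tri : ℕ → ℕ
tri zero    = zero
tri (suc n) = suc n + tri n

pair : ℕ → ℕ → ℕ
pair x y = tri (x + y) + y

code : List ℕ → ℕ
code []       = zero
code (x ∷ xs) = suc (pair x (code xs))

-- Oracle partial recursive (μ-recursive) functions, as the model of
-- computability relative to an oracle o : ℕ → ℕ.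

data PR : ℕ → Set where
  Z      : ∀ {k} → PR k
  S      : PR 1
  Proj   : ∀ {k} → Fin k → PR k
  Oracle : PR 1
  Comp   : ∀ {m k} → PR m → Vec (PR k) m → PR k
  Rec    : ∀ {k} → PR k → PR (suc (suc k)) → PR (suc k)
  Mu     : ∀ {k} → PR (suc k) → PR k

lookupV : ∀ {A : Set} {k} → Vec A k → Fin k → A
lookupV (x ∷ xs) Fin.zero    = x
lookupV (x ∷ xs) (Fin.suc i) = lookupV xs i

-- big-step (relational, hence partial) evaluation relative to oracle o
mutual
  data Eval (o : Baire) : ∀ {k} → PR k → Vec ℕ k → ℕ → Set where
    eZ    : ∀ {k} {xs : Vec ℕ k} → Eval o Z xs zero
    eS    : ∀ {x} → Eval o S (x ∷ []) (suc x)
    eProj : ∀ {k} {i : Fin k} {xs} → Eval o (Proj i) xs (lookupV xs i)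
    eOr   : ∀ {x} → Eval o Oracle (x ∷ []) (o x)
    eComp : ∀ {m k} {f : PR m} {gs : Vec (PR k) m} {xs ys y} →
            EvalAll o xs gs ys → Eval o f ys y → Eval o (Comp f gs) xs y
    eRec0 : ∀ {k} {g : PR k} {h} {xs y} →
            Eval o g xs y → Eval o (Rec g h) (zero ∷ xs) y
    eRecS : ∀ {k} {g : PR k} {h} {n xs z y} →
            Eval o (Rec g h) (n ∷ xs) z → Eval o h (n ∷ z ∷ xs) y →
            Eval o (Rec g h) (suc n ∷ xs) y
    eMu   : ∀ {k} {f : PR (suc k)} {xs y} →
            Eval o f (y ∷ xs) zero →
            (∀ z → z < y → Σ ℕ (λ v → Eval o f (z ∷ xs) (suc v))) →
            Eval o (Mu f) xs y

  data EvalAll (o : Baire) {k} (xs : Vec ℕ k) : ∀ {m} → Vec (PR k) m → Vec ℕ m → Set where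
    [] : EvalAll o xs [] []
    _∷_ : ∀ {m} {g : PR k} {gs : Vec (PR k) m} {y ys} →
          Eval o g xs y → EvalAll o xs gs ys → EvalAll o xs (g ∷ gs) (y ∷ ys)

Computes : PR 1 → Baire → Baire → Set
Computes e p q = ∀ n → Eval p e (n ∷ []) (q n)

-- Problems given directly on names (Baire space), strong Weihrauch reducibility

record Problem : Set₁ where
  field
    Dom : Baire → Set
    Sol : Baire → Baire → Set     -- r is a name of a solution of the instance named by p

open Problem

_≤sW_ : Problem → Problem → Set
P ≤sW Q = Σ (PR 1) λ Φ → Σ (PR 1) λ Ψ →
  ∀ p → Dom P p →
    Σ Baire λ q → Computes Φ p q × Dom Q q ×
      (∀ r → Sol Q q r → Σ Baire λ s → Computes Ψ r s × Sol P p s)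

_≡sW_ : Problem → Problem → Set
P ≡sW Q = (P ≤sW Q) × (Q ≤sW P)

IsBinary : Baire → Set
IsBinary p = ∀ k → p k ≤ 1

-- WF-hat.  A name p of a sequence of trees ⟨T_i⟩ is a {0,1}-valued
-- function with  σ ∈ T_i  iff  p (pair i (code σ)) ≡ 1, each T_i closed
-- under prefixes.

InTree : Baire → ℕ → List ℕ → Set
InTree p i σ = p (pair i (code σ)) ≡ 1

IsTreeSeq : Baire → Set
IsTreeSeq p = IsBinary p × (∀ i σ x → InTree p i (σ ++ (x ∷ [])) → InTree p i σ)

HasPath : Baire → ℕ → Set
HasPath p i = Σ Baire λ f → ∀ n → InTree p i (map f (upTo n))

WFhat : Problem
Dom WFhat = IsTreeSeq
Sol WFhat p w = ∀ i → (w i ≡ 0 × HasPath p i) ⊎ (w i ≡ 1 × ¬ HasPath p i)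

Edge : Baire → ℕ → ℕ → Set
Edge p u v = p (pair u v) ≡ 1

IsGraph : Baire → Set
IsGraph p = IsBinary p × (∀ u v → Edge p u v → Edge p v u) × (∀ u → ¬ Edge p u u)

-- L_n : vertices v_i (inj₁ i) plus n+2 new cycle vertices c_j (inj₂ j),
-- forming with v_0 a cycle of length n+3.
LV : ℕ → Set
LV n = ℕ ⊎ Fin (suc (suc n))

data LE (n : ℕ) : LV n → LV n → Set where
  path     : ∀ i → LE n (inj₁ i) (inj₁ (suc i))
  cycStart : LE n (inj₁ zero) (inj₂ Fin.zero)
  cyc      : (j : Fin (suc n)) → LE n (inj₂ (inject₁ j)) (inj₂ (Fin.suc j))
  cycEnd   : LE n (inj₂ (fromℕ (suc n))) (inj₁ zero)

-- L_n is isomorphic to a (not necessarily induced) subgraph of G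
SubgraphL : ℕ → Baire → Set
SubgraphL n p = Σ (LV n → ℕ) λ f → Injective _≡_ _≡_ f ×
                  (∀ a b → LE n a b → Edge p (f a) (f b))

SL : Problem
Dom SL = IsGraph
Sol SL p s = ∀ n → (s n ≡ 1 × SubgraphL n p) ⊎ (s n ≡ 0 × ¬ SubgraphL n p)

{-# OPTIONS --safe #-}
module Submission where

-- Both reductions are uniform and turn answers into answers by w ↦ 1 ∸ w.
--
-- From trees to a graph: component m of the graph is a cycle of length m+3
-- with (a copy of) the tree T_m hanging from one of its vertices.  An infinite
-- path through T_n gives an embedding of L_n along component n.  Conversely,
-- the image of the cycle of L_n avoids the trees, since the label of a tree
-- node is a potential with at most one lower neighbour, which cannot peak on a
-- cycle; it then runs around the whole cycle of its component (otherwise the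
-- offset from a missed position would be such a potential), so that component
-- is the n-th one, and the image of the ray descends through T_n.
--
-- From a graph to trees: T_n consists of the sequences of distinct vertices
-- that are initial segments of an embedding of L_n, listing v₀, then the cycle,
-- then v₁, v₂, …; its infinite paths are exactly the embeddings.

open import Defs
open import Data.Nat using (ℕ; zero; suc; pred; _+_; _∸_; _<_; _≤_; _<?_; z≤n; s≤s)
open import Data.Nat.Properties
open import Data.Nat.GeneralisedArithmetic using (fold; iterate; iterate-is-fold)
open import Data.Fin using (Fin; toℕ; inject₁; fromℕ; fromℕ<)
open import Data.Fin.Properties
  using (toℕ<n; toℕ-fromℕ; toℕ-inject₁; toℕ-fromℕ<; toℕ-injective; cantor-schröder-bernstein)
open import Data.Vec using (Vec; []; _∷_; head; tail)
import Data.Vec as Vec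
open import Data.List using (List; []; _∷_; _++_; _∷ʳ_; foldl; length; reverse; map; upTo)
open import Data.List.Properties using (unfold-reverse; map-++; upTo-∷ʳ; foldl-∷ʳ)
open import Data.Empty using (⊥; ⊥-elim)
open import Data.Sum using (_⊎_; inj₁; inj₂)
open import Data.Product using (Σ; _×_; _,_; proj₁; proj₂)
open import Function using (flip)
open import Function.Definitions using (Injective)
open import Relation.Binary.Definitions using (tri<; tri≈; tri>)
open import Relation.Nullary using (¬_; yes; no)
open import Relation.Binary.PropositionalEquality

-- A term together with the total function it computes relative to every
-- oracle.  withFun swaps in an extensionally equal function, so that the
-- functions of composite programs stay in readable closed form.
record Prog (k : ℕ) : Set where
  constructor mkProg
  field
    fun  : Baire → Vec ℕ k → ℕ
    term : PR k
    eval : ∀ o xs → Eval o term xs (fun o xs)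
open Prog

withFun : ∀ {k} (P : Prog k) (f : Baire → Vec ℕ k → ℕ) → (∀ o xs → fun P o xs ≡ f o xs) → Prog k
withFun P f eq = mkProg f (term P) (λ o xs → subst (Eval o (term P) xs) (eq o xs) (eval P o xs))

computes : (P : Prog 1) (o : Baire) → Computes (term P) o (λ n → fun P o (n ∷ []))
computes P o n = eval P o (n ∷ [])

unary : (ℕ → ℕ) → Vec ℕ 1 → ℕ
unary f (x ∷ []) = f x

binary : (ℕ → ℕ → ℕ) → Vec ℕ 2 → ℕ
binary f (x ∷ y ∷ []) = f x y

ternary : (ℕ → ℕ → ℕ → ℕ) → Vec ℕ 3 → ℕ
ternary f (x ∷ y ∷ z ∷ []) = f x y z

zeroP : ∀ {k} → Prog k
zeroP = mkProg (λ _ _ → 0) Z (λ _ _ → eZ)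

sucP : Prog 1
sucP = mkProg (λ _ → unary suc) S (λ { _ (x ∷ []) → eS })

projP : ∀ {k} → Fin k → Prog k
projP i = mkProg (λ _ xs → lookupV xs i) (Proj i) (λ _ _ → eProj)

oracleP : Prog 1
oracleP = mkProg (λ o → unary o) Oracle (λ { _ (x ∷ []) → eOr })

evalAll : ∀ {k m} (Ps : Vec (Prog k) m) o xs →
          EvalAll o xs (Vec.map term Ps) (Vec.map (λ P → fun P o xs) Ps)
evalAll []       o xs = []
evalAll (P ∷ Ps) o xs = eval P o xs ∷ evalAll Ps o xs

compP : ∀ {k m} → Prog m → Vec (Prog k) m → Prog k
compP F Ps = mkProg (λ o xs → fun F o (Vec.map (λ P → fun P o xs) Ps)) (Comp (term F) (Vec.map term Ps))
                    (λ o xs → eComp (evalAll Ps o xs) (eval F o _))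

primRec : ∀ {k} → (Vec ℕ k → ℕ) → (Vec ℕ (2 + k) → ℕ) → ℕ → Vec ℕ k → ℕ
primRec g h zero    xs = g xs
primRec g h (suc n) xs = h (n ∷ primRec g h n xs ∷ xs)

recP : ∀ {k} → Prog k → Prog (2 + k) → Prog (suc k)
recP G H = mkProg (λ o xs → primRec (fun G o) (fun H o) (head xs) (tail xs)) (Rec (term G) (term H))
                  (λ { o (n ∷ xs) → evalRec o n xs })
  where
  evalRec : ∀ o n xs → Eval o (Rec (term G) (term H)) (n ∷ xs) (primRec (fun G o) (fun H o) n xs)
  evalRec o zero    xs = eRec0 (eval G o xs)
  evalRec o (suc n) xs = eRecS (evalRec o n xs) (eval H o _)

app₁ : ∀ {k} → Prog 1 → Prog k → Prog k
app₁ F P = compP F (P ∷ [])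

app₂ : ∀ {k} → Prog 2 → Prog k → Prog k → Prog k
app₂ F P Q = compP F (P ∷ Q ∷ [])

app₃ : ∀ {k} → Prog 3 → Prog k → Prog k → Prog k → Prog k
app₃ F P Q R = compP F (P ∷ Q ∷ R ∷ [])

π₀ : ∀ {k} → Prog (1 + k)
π₀ = projP Fin.zero

π₁ : ∀ {k} → Prog (2 + k)
π₁ = projP (Fin.suc Fin.zero)

π₂ : ∀ {k} → Prog (3 + k)
π₂ = projP (Fin.suc (Fin.suc Fin.zero))

π₃ : ∀ {k} → Prog (4 + k)
π₃ = projP (Fin.suc (Fin.suc (Fin.suc Fin.zero)))

sucᴾ : ∀ {k} → Prog k → Prog k
sucᴾ = app₁ sucP

constᴾ : ∀ {k} → ℕ → Prog k
constᴾ c = withFun (numeral c) (λ _ _ → c) (numeral-fun c)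
  where
  numeral : ∀ {k} → ℕ → Prog k
  numeral zero    = zeroP
  numeral (suc c) = sucᴾ (numeral c)
  numeral-fun : ∀ {k} c o (xs : Vec ℕ k) → fun (numeral c) o xs ≡ c
  numeral-fun zero    o xs = refl
  numeral-fun (suc c) o xs = cong suc (numeral-fun c o xs)

addProg : Prog 2
addProg = withFun (recP π₀ (sucᴾ π₁)) (λ _ → binary _+_) (λ { o (x ∷ y ∷ []) → plus x y o })
  where
  plus : ∀ x y o → fun (recP π₀ (sucᴾ π₁)) o (x ∷ y ∷ []) ≡ x + y
  plus zero    y o = refl
  plus (suc x) y o = cong suc (plus x y o)

predProg : Prog 1
predProg = withFun (recP zeroP π₀) (λ _ → unary pred) (λ { o (zero ∷ []) → refl ; o (suc x ∷ []) → refl })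

monusProg : Prog 2
monusProg = withFun (compP flipped (π₁ ∷ π₀ ∷ [])) (λ _ → binary _∸_) (λ { o (x ∷ y ∷ []) → monus y x o })
  where
  flipped : Prog 2
  flipped = recP π₀ (app₁ predProg π₁)
  monus : ∀ y x o → fun flipped o (y ∷ x ∷ []) ≡ x ∸ y
  monus zero    x o = refl
  monus (suc y) x o = trans (cong pred (monus y x o)) (pred[m∸n]≡m∸[1+n] x y)

-- Truth values are 1 and 0; the connectives read any nonzero number as true.
isZero : ℕ → ℕ
isZero zero    = 1
isZero (suc _) = 0

ifZero : ℕ → ℕ → ℕ → ℕ
ifZero zero    a b = a
ifZero (suc _) a b = b

eqℕ : ℕ → ℕ → ℕ
eqℕ x y = isZero ((x ∸ y) + (y ∸ x))

leℕ : ℕ → ℕ → ℕ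
leℕ x y = isZero (x ∸ y)

andℕ : ℕ → ℕ → ℕ
andℕ a b = ifZero a 0 b

orℕ : ℕ → ℕ → ℕ
orℕ a b = ifZero a b 1

isNonzero : ℕ → ℕ
isNonzero x = isZero (isZero x)

isZeroProg : Prog 1
isZeroProg = withFun (recP (constᴾ 1) zeroP) (λ _ → unary isZero)
                     (λ { o (zero ∷ []) → refl ; o (suc x ∷ []) → refl })

ifZeroProg : Prog 3
ifZeroProg = withFun (recP π₀ π₃) (λ _ → ternary ifZero)
                     (λ { o (zero ∷ a ∷ b ∷ []) → refl ; o (suc c ∷ a ∷ b ∷ []) → refl })

predᴾ : ∀ {k} → Prog k → Prog k
predᴾ = app₁ predProg

_+ᴾ_ _∸ᴾ_ : ∀ {k} → Prog k → Prog k → Prog k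
_+ᴾ_ = app₂ addProg
_∸ᴾ_ = app₂ monusProg

isZeroᴾ : ∀ {k} → Prog k → Prog k
isZeroᴾ = app₁ isZeroProg

ifZeroᴾ : ∀ {k} → Prog k → Prog k → Prog k → Prog k
ifZeroᴾ = app₃ ifZeroProg

eqᴾ leᴾ andᴾ orᴾ : ∀ {k} → Prog k → Prog k → Prog k
eqᴾ P Q = isZeroᴾ ((P ∸ᴾ Q) +ᴾ (Q ∸ᴾ P))
leᴾ P Q = isZeroᴾ (P ∸ᴾ Q)
andᴾ P Q = ifZeroᴾ P (constᴾ 0) Q
orᴾ P Q = ifZeroᴾ P Q (constᴾ 1)

isZero≡1⇒≡0 : ∀ {x} → isZero x ≡ 1 → x ≡ 0
isZero≡1⇒≡0 {zero} _ = refl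

≤⇒leℕ≡1 : ∀ {x y} → x ≤ y → leℕ x y ≡ 1
≤⇒leℕ≡1 x≤y rewrite m≤n⇒m∸n≡0 x≤y = refl

>⇒leℕ≡0 : ∀ {x y} → y < x → leℕ x y ≡ 0
>⇒leℕ≡0 {x} {y} y<x with x ∸ y | m>n⇒m∸n≢0 y<x
... | zero  | x∸y≢0 = ⊥-elim (x∸y≢0 refl)
... | suc _ | _     = refl

leℕ≢0⇒≤ : ∀ {x y} → leℕ x y ≢ 0 → x ≤ y
leℕ≢0⇒≤ {x} {y} le≢0 with x ≤? y
... | yes x≤y = x≤y
... | no  x≰y = ⊥-elim (le≢0 (>⇒leℕ≡0 (≰⇒> x≰y)))

eqℕ-refl : ∀ x → eqℕ x x ≡ 1
eqℕ-refl x rewrite n∸n≡0 x = refl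

eqℕ≡1⇒≡ : ∀ {x y} → eqℕ x y ≡ 1 → x ≡ y
eqℕ≡1⇒≡ {x} {y} eq =
  ≤-antisym (m∸n≡0⇒m≤n (m+n≡0⇒m≡0 _ both≡0)) (m∸n≡0⇒m≤n (m+n≡0⇒n≡0 (x ∸ y) both≡0))
  where
  both≡0 : (x ∸ y) + (y ∸ x) ≡ 0
  both≡0 = isZero≡1⇒≡0 eq

eqℕ≤1 : ∀ x y → eqℕ x y ≤ 1
eqℕ≤1 x y with (x ∸ y) + (y ∸ x)
... | zero  = ≤-refl
... | suc _ = z≤n

≢⇒eqℕ≡0 : ∀ {x y} → x ≢ y → eqℕ x y ≡ 0
≢⇒eqℕ≡0 {x} {y} x≢y with (x ∸ y) + (y ∸ x) in eq
... | zero  = ⊥-elim (x≢y (eqℕ≡1⇒≡ (cong isZero eq)))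
... | suc _ = refl

eqℕ≢0⇒≡ : ∀ {x y} → eqℕ x y ≢ 0 → x ≡ y
eqℕ≢0⇒≡ {x} {y} eq≢0 with eqℕ x y in eq | eqℕ≤1 x y
... | zero        | _       = ⊥-elim (eq≢0 refl)
... | suc zero    | _       = eqℕ≡1⇒≡ eq
... | suc (suc _) | s≤s ()

andℕ≢0⇒ : ∀ {a b} → andℕ a b ≢ 0 → a ≢ 0 × b ≢ 0
andℕ≢0⇒ {zero}  and≢0 = ⊥-elim (and≢0 refl)
andℕ≢0⇒ {suc a} and≢0 = (λ ()) , and≢0

orℕ≢0⇒ : ∀ {a b} → orℕ a b ≢ 0 → a ≢ 0 ⊎ b ≢ 0
orℕ≢0⇒ {zero}  or≢0 = inj₂ or≢0
orℕ≢0⇒ {suc a} _    = inj₁ (λ ())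

orℕ-≡1ˡ : ∀ {a} b → a ≡ 1 → orℕ a b ≡ 1
orℕ-≡1ˡ b refl = refl

orℕ-≡1ʳ : ∀ a {b} → b ≡ 1 → orℕ a b ≡ 1
orℕ-≡1ʳ zero    b≡1 = b≡1
orℕ-≡1ʳ (suc a) _   = refl

isNonzero≤1 : ∀ a → isNonzero a ≤ 1
isNonzero≤1 zero    = z≤n
isNonzero≤1 (suc a) = ≤-refl

isNonzero≢0⇒ : ∀ {a} → isNonzero a ≢ 0 → a ≢ 0
isNonzero≢0⇒ {zero}  nz = ⊥-elim (nz refl)
isNonzero≢0⇒ {suc a} _  = λ ()

≢0⇒isNonzero≡1 : ∀ {a} → a ≢ 0 → isNonzero a ≡ 1
≢0⇒isNonzero≡1 {zero}  a≢0 = ⊥-elim (a≢0 refl)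
≢0⇒isNonzero≡1 {suc a} _   = refl

≡1⇒≢0 : ∀ {a} → a ≡ 1 → a ≢ 0
≡1⇒≢0 refl ()

tri-mono-< : ∀ {s t} → s < t → tri (suc s) ≤ tri t
tri-mono-< {s} {suc t} (s≤s s≤t) with m≤n⇒m<n∨m≡n s≤t
... | inj₁ s<t  = ≤-trans (tri-mono-< s<t) (m≤n+m (tri t) (suc t))
... | inj₂ refl = ≤-refl

triRoot : ℕ → ℕ
triRoot zero    = 0
triRoot (suc k) = ifZero (leℕ (tri (suc (triRoot k))) (suc k)) (triRoot k) (suc (triRoot k))

triRoot-spec : ∀ k → tri (triRoot k) ≤ k × k < tri (suc (triRoot k))
triRoot-spec zero = z≤n , s≤s z≤n
triRoot-spec (suc k) with triRoot-spec k | tri (suc (triRoot k)) ≤? suc k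
... | lower , upper | yes next≤ rewrite ≤⇒leℕ≡1 next≤ =
  next≤ , ≤-trans (s≤s upper) (s≤s (m≤n+m _ (suc (triRoot k))))
... | lower , upper | no next≰ rewrite >⇒leℕ≡0 (≰⇒> next≰) =
  ≤-trans lower (n≤1+n k) , ≰⇒> next≰

triRoot-unique : ∀ {s k} → tri s ≤ k → k < tri (suc s) → triRoot k ≡ s
triRoot-unique {s} {k} lower upper with <-cmp (triRoot k) s | triRoot-spec k
... | tri< r<s _ _ | _ , upper′ = ⊥-elim (<-irrefl refl (<-≤-trans upper′ (≤-trans (tri-mono-< r<s) lower)))
... | tri≈ _ r≡s _ | _          = r≡s
... | tri> _ _ s<r | lower′ , _ = ⊥-elim (<-irrefl refl (<-≤-trans upper (≤-trans (tri-mono-< s<r) lower′)))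

triRoot-pair : ∀ x y → triRoot (pair x y) ≡ x + y
triRoot-pair x y = triRoot-unique (m≤m+n _ y) upper
  where
  upper : pair x y < tri (suc (x + y))
  upper = subst (_< tri (suc (x + y))) (+-comm y (tri (x + y))) (+-monoˡ-< (tri (x + y)) (s≤s (m≤n+m y x)))

-- Opaque, so that pair₁ and pair₂ are only ever handled through the lemmas below
-- and never unfolded into triRoot.
opaque
  pair₂ : ℕ → ℕ
  pair₂ k = k ∸ tri (triRoot k)

  pair₁ : ℕ → ℕ
  pair₁ k = triRoot k ∸ pair₂ k

triProg : Prog 1
triProg = withFun (recP zeroP (sucᴾ π₀ +ᴾ π₁)) (λ _ → unary tri) (λ { o (x ∷ []) → triangle x o })
  where
  triangle : ∀ n o → fun (recP zeroP (sucᴾ π₀ +ᴾ π₁)) o (n ∷ []) ≡ tri n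
  triangle zero    o = refl
  triangle (suc n) o = cong (suc n +_) (triangle n o)

pairProg : Prog 2
pairProg = withFun (app₁ triProg (π₀ +ᴾ π₁) +ᴾ π₁) (λ _ → binary pair) (λ { o (x ∷ y ∷ []) → refl })

triRootProg : Prog 1
triRootProg = withFun root (λ _ → unary triRoot) (λ { o (x ∷ []) → rooted x o })
  where
  root : Prog 1
  root = recP zeroP (ifZeroᴾ (leᴾ (app₁ triProg (sucᴾ π₁)) (sucᴾ π₀)) π₁ (sucᴾ π₁))
  rooted : ∀ k o → fun root o (k ∷ []) ≡ triRoot k
  rooted zero    o = refl
  rooted (suc k) o rewrite rooted k o = refl

pair₂Prog : Prog 1
pair₂Prog = withFun (π₀ ∸ᴾ app₁ triProg (app₁ triRootProg π₀)) (λ _ → unary pair₂) correct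
  where
  opaque
    unfolding pair₂
    correct : ∀ o xs → fun (π₀ ∸ᴾ app₁ triProg (app₁ triRootProg π₀)) o xs ≡ unary pair₂ xs
    correct o (x ∷ []) = refl

pair₁Prog : Prog 1
pair₁Prog = withFun (app₁ triRootProg π₀ ∸ᴾ app₁ pair₂Prog π₀) (λ _ → unary pair₁) correct
  where
  opaque
    unfolding pair₁
    correct : ∀ o xs → fun (app₁ triRootProg π₀ ∸ᴾ app₁ pair₂Prog π₀) o xs ≡ unary pair₁ xs
    correct o (x ∷ []) = refl

pairᴾ : ∀ {k} → Prog k → Prog k → Prog k
pairᴾ = app₂ pairProg

pair₁ᴾ pair₂ᴾ : ∀ {k} → Prog k → Prog k
pair₁ᴾ = app₁ pair₁Prog
pair₂ᴾ = app₁ pair₂Prog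

opaque
  unfolding pair₁ pair₂

  pair₂-pair : ∀ x y → pair₂ (pair x y) ≡ y
  pair₂-pair x y rewrite triRoot-pair x y = m+n∸m≡n (tri (x + y)) y

  pair₁-pair : ∀ x y → pair₁ (pair x y) ≡ x
  pair₁-pair x y rewrite pair₂-pair x y | triRoot-pair x y = m+n∸n≡m x y

  pair₂≤triRoot : ∀ k → pair₂ k ≤ triRoot k
  pair₂≤triRoot k = ≤-pred (subst (pair₂ k <_) (m+n∸n≡m (suc s) (tri s)) (∸-monoˡ-< upper lower))
    where
    s : ℕ
    s = triRoot k
    lower : tri s ≤ k
    lower = proj₁ (triRoot-spec k)
    upper : k < suc s + tri s
    upper = proj₂ (triRoot-spec k)

  pair-pair₁-pair₂ : ∀ k → pair (pair₁ k) (pair₂ k) ≡ k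
  pair-pair₁-pair₂ k rewrite m∸n+n≡m (pair₂≤triRoot k) = m+[n∸m]≡n (proj₁ (triRoot-spec k))

  pair₂≤ : ∀ k → pair₂ k ≤ k
  pair₂≤ k = m∸n≤m k (tri (triRoot k))

pair-injective : ∀ {a b c d} → pair a b ≡ pair c d → a ≡ c × b ≡ d
pair-injective {a} {b} {c} {d} eq =
  trans (sym (pair₁-pair a b)) (trans (cong pair₁ eq) (pair₁-pair c d)) ,
  trans (sym (pair₂-pair a b)) (trans (cong pair₂ eq) (pair₂-pair c d))

m≤pair[n,m] : ∀ n m → m ≤ pair n m
m≤pair[n,m] n m = m≤n+m m (tri (n + m))

code-injective : ∀ {l m} → code l ≡ code m → l ≡ m
code-injective {[]}    {[]}    eq = refl
code-injective {x ∷ l} {y ∷ m} eq with pair-injective (suc-injective eq)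
... | x≡y , codes≡ = cong₂ _∷_ x≡y (code-injective codes≡)

length≤code : ∀ l → length l ≤ code l
length≤code []      = z≤n
length≤code (x ∷ l) = s≤s (≤-trans (length≤code l) (m≤pair[n,m] x (code l)))

-- A state pair c a holds the code c of the unread part of the list and the
-- accumulator a; each step reads one element, and code l steps suffice.
foldStep : (ℕ → ℕ → ℕ) → ℕ → ℕ
foldStep f st = ifZero (pair₁ st) st (pair (pair₂ (pred (pair₁ st))) (f (pair₁ (pred (pair₁ st))) (pair₂ st)))

foldCode : (ℕ → ℕ → ℕ) → ℕ → ℕ → ℕ
foldCode f c a = pair₂ (fold (pair c a) (foldStep f) c)

iterate-foldStep : ∀ f l a n → length l ≤ n →
                   iterate (foldStep f) (pair (code l) a) n ≡ pair 0 (foldl (flip f) a l)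
iterate-foldStep f []      a zero    _ = refl
iterate-foldStep f []      a (suc n) _ rewrite pair₁-pair 0 a = iterate-foldStep f [] a n z≤n
iterate-foldStep f (x ∷ l) a (suc n) (s≤s l≤n)
  rewrite pair₁-pair (code (x ∷ l)) a | pair₂-pair (code (x ∷ l)) a
        | pair₁-pair x (code l) | pair₂-pair x (code l) = iterate-foldStep f l (f x a) n l≤n

foldCode-code : ∀ f l a → foldCode f (code l) a ≡ foldl (flip f) a l
foldCode-code f l a
  rewrite iterate-is-fold (pair (code l) a) (foldStep f) (code l)
        | iterate-foldStep f l a (code l) (length≤code l) = pair₂-pair 0 _

-- F is applied to (element , accumulator , parameter).
module _ (F : Prog 3) where

  foldStepᴾ : Prog 2
  foldStepᴾ = ifZeroᴾ c π₀ (pairᴾ (pair₂ᴾ c-1) (compP F (pair₁ᴾ c-1 ∷ pair₂ᴾ π₀ ∷ π₁ ∷ [])))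
    where
    c c-1 : Prog 2
    c = pair₁ᴾ π₀
    c-1 = predᴾ c

  foldᴾ : Prog 3
  foldᴾ = recP π₀ (compP foldStepᴾ (π₁ ∷ π₃ ∷ []))

  foldCodeᴾ : Prog 3
  foldCodeᴾ = pair₂ᴾ (compP foldᴾ (π₀ ∷ pairᴾ π₀ π₁ ∷ π₂ ∷ []))

  foldᴾ-fun : ∀ o n s par → fun foldᴾ o (n ∷ s ∷ par ∷ []) ≡
              fold s (foldStep (λ x acc → fun F o (x ∷ acc ∷ par ∷ []))) n
  foldᴾ-fun o zero    s par = refl
  foldᴾ-fun o (suc n) s par rewrite foldᴾ-fun o n s par = refl

  foldCodeᴾ-fun : ∀ o c a par →
    fun foldCodeᴾ o (c ∷ a ∷ par ∷ []) ≡ foldCode (λ x acc → fun F o (x ∷ acc ∷ par ∷ [])) c a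
  foldCodeᴾ-fun o c a par = cong pair₂ (foldᴾ-fun o c (pair c a) par)

revPrefix : Baire → ℕ → List ℕ
revPrefix h zero    = []
revPrefix h (suc k) = h k ∷ revPrefix h k

reverse-revPrefix : ∀ h k → reverse (revPrefix h k) ≡ map h (upTo k)
reverse-revPrefix h zero    = refl
reverse-revPrefix h (suc k) = begin
  reverse (h k ∷ revPrefix h k)        ≡⟨ unfold-reverse (h k) (revPrefix h k) ⟩
  reverse (revPrefix h k) ∷ʳ h k       ≡⟨ cong (_∷ʳ h k) (reverse-revPrefix h k) ⟩
  map h (upTo k) ++ map h (k ∷ [])     ≡⟨ map-++ h (upTo k) (k ∷ []) ⟨
  map h (upTo k ∷ʳ k)                  ≡⟨ cong (map h) (upTo-∷ʳ k) ⟩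
  map h (upTo (suc k))                 ∎
  where open ≡-Reasoning

length-revPrefix : ∀ h k → length (revPrefix h k) ≡ k
length-revPrefix h zero    = refl
length-revPrefix h (suc k) = cong suc (length-revPrefix h k)

inject₁-fromℕ< : ∀ {j m} (j< : j < m) (j<′ : j < suc m) → inject₁ (fromℕ< j<) ≡ fromℕ< j<′
inject₁-fromℕ< j< j<′ = toℕ-injective (trans (toℕ-inject₁ _) (trans (toℕ-fromℕ< j<) (sym (toℕ-fromℕ< j<′))))

fromℕ≡fromℕ< : ∀ {m} (m< : m < suc m) → fromℕ m ≡ fromℕ< m<
fromℕ≡fromℕ< {m} m< = toℕ-injective (trans (toℕ-fromℕ m) (sym (toℕ-fromℕ< m<)))

bounded-argmax : (g : ℕ → ℕ) (N : ℕ) → Σ ℕ λ i → i ≤ N × (∀ j → j ≤ N → g j ≤ g i)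
bounded-argmax g zero = 0 , z≤n , λ { zero _ → ≤-refl }
bounded-argmax g (suc N) with bounded-argmax g N
... | i , i≤N , maximal with g (suc N) ≤? g i
...   | yes last≤ = i , m≤n⇒m≤1+n i≤N , bound
  where
  bound : ∀ j → j ≤ suc N → g j ≤ g i
  bound j j≤ with m≤n⇒m<n∨m≡n j≤
  ... | inj₁ j<   = maximal j (≤-pred j<)
  ... | inj₂ refl = last≤
...   | no last≰ = suc N , ≤-refl , bound
  where
  bound : ∀ j → j ≤ suc N → g j ≤ g (suc N)
  bound j j≤ with m≤n⇒m<n∨m≡n j≤
  ... | inj₁ j<   = ≤-trans (maximal j (≤-pred j<)) (<⇒≤ (≰⇒> last≰))
  ... | inj₂ refl = ≤-refl

AtMostOneLowerNeighbour : {X : Set} → (X → X → Set) → (X → ℕ) → Set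
AtMostOneLowerNeighbour R φ =
  ∀ u v v′ → R v u → R u v′ → φ v ≤ φ u → φ v′ ≤ φ u → 0 < φ u → v ≡ v′

module _ {X : Set} (R : X → X → Set) (w : ℕ → X) (K : ℕ) (closed : w (3 + K) ≡ w 0)
         (step : ∀ i → i < 3 + K → R (w i) (w (suc i))) where

  record CycleNeighbours (i : ℕ) : Set where
    field
      before after : ℕ
      before≤      : before ≤ 2 + K
      after≤       : after ≤ 2 + K
      before≢after : before ≢ after
      into         : R (w before) (w i)
      out          : R (w i) (w after)

  cycleNeighbours : ∀ i → i ≤ 2 + K → CycleNeighbours i
  cycleNeighbours zero _ = record
    { before = 2 + K ; after = 1 ; before≤ = ≤-refl ; after≤ = s≤s z≤n ; before≢after = λ ()
    ; into = subst (R (w (2 + K))) closed (step (2 + K) ≤-refl) ; out = step 0 (s≤s z≤n) }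
  cycleNeighbours (suc j) (s≤s j≤) with m≤n⇒m<n∨m≡n j≤
  ... | inj₁ j< = record
    { before = j ; after = 2 + j ; before≤ = ≤-trans (<⇒≤ j<) (n≤1+n _) ; after≤ = s≤s j<
    ; before≢after = <⇒≢ (≤-trans (n<1+n j) (n≤1+n _))
    ; into = step j (≤-trans (s≤s (<⇒≤ j<)) (n≤1+n _)) ; out = step (suc j) (m≤n⇒m≤1+n (s≤s j<)) }
  ... | inj₂ refl = record
    { before = suc K ; after = 0 ; before≤ = n≤1+n _ ; after≤ = z≤n ; before≢after = λ ()
    ; into = step (suc K) (n≤1+n _) ; out = subst (R (w (2 + K))) closed (step (2 + K) ≤-refl) }

  -- At a maximum of φ on the cycle both cycle neighbours are lower, hence equal.
  potential-vanishes-on-cycle :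
    (φ : X → ℕ) → (∀ i j → i < 3 + K → j < 3 + K → w i ≡ w j → i ≡ j) →
    AtMostOneLowerNeighbour R φ → ∀ i → i < 3 + K → φ (w i) ≡ 0
  potential-vanishes-on-cycle φ injective unique i i<
    with bounded-argmax (λ j → φ (w j)) (2 + K)
  ... | top , top≤ , maximal with 0 <? φ (w top)
  ...   | no  top≯0 = n≤0⇒n≡0 (≤-trans (maximal i (≤-pred i<)) (≮⇒≥ top≯0))
  ...   | yes top>0 = ⊥-elim (before≢after (injective before after (s≤s before≤) (s≤s after≤)
                        (unique (w top) (w before) (w after) into out
                                (maximal before before≤) (maximal after after≤) top>0)))
    where open CycleNeighbours (cycleNeighbours top top≤)

-- offset k counts the forward steps from P to k around the cycle 0, 1, …, m+2
-- (offset P is the full length m+3): it goes up by one along every edge of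
-- the cycle that avoids P.
module CycleOffset (m P : ℕ) (P≤ : P ≤ 2 + m) where

  offset : ℕ → ℕ
  offset k with P <? k
  ... | yes _ = k ∸ P
  ... | no  _ = k + (3 + m) ∸ P

  offset-spec : ∀ k → (P < k × offset k + P ≡ k) ⊎ (k ≤ P × offset k + P ≡ k + (3 + m))
  offset-spec k with P <? k
  ... | yes P<k = inj₁ (P<k , m∸n+n≡m (<⇒≤ P<k))
  ... | no  P≮k = inj₂ (≮⇒≥ P≮k , m∸n+n≡m (≤-trans P≤ (≤-trans (n≤1+n _) (m≤n+m (3 + m) k))))

  private
    wrapped≢ : ∀ k j → j ≤ 2 + m → k + (3 + m) ≢ j
    wrapped≢ k j j≤ eq = <-irrefl refl (≤-trans (m≤n+m (3 + m) k) (subst (_≤ 2 + m) (sym eq) j≤))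

  offset-positive : ∀ k → 0 < offset k
  offset-positive k with offset k | offset-spec k
  ... | suc _ | _             = s≤s z≤n
  ... | zero  | inj₁ (P<k , eq) = ⊥-elim (<-irrefl eq P<k)
  ... | zero  | inj₂ (_ , eq)   = ⊥-elim (wrapped≢ k P P≤ (sym eq))

  offset-injective : ∀ k k′ → k ≤ 2 + m → k′ ≤ 2 + m → offset k ≡ offset k′ → k ≡ k′
  offset-injective k k′ k≤ k′≤ eq with offset-spec k | offset-spec k′
  ... | inj₁ (_ , e) | inj₁ (_ , e′) = trans (sym e) (trans (cong (_+ P) eq) e′)
  ... | inj₂ (_ , e) | inj₂ (_ , e′) = +-cancelʳ-≡ (3 + m) k k′ (trans (sym e) (trans (cong (_+ P) eq) e′))
  ... | inj₁ (_ , e) | inj₂ (_ , e′) = ⊥-elim (wrapped≢ k′ k k≤ (trans (sym e′) (trans (cong (_+ P) (sym eq)) e)))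
  ... | inj₂ (_ , e) | inj₁ (_ , e′) = ⊥-elim (wrapped≢ k k′ k′≤ (trans (sym e) (trans (cong (_+ P) eq) e′)))

  offset-suc : ∀ k → k ≢ P → suc k ≢ P → offset (suc k) ≡ suc (offset k)
  offset-suc k k≢P 1+k≢P with offset-spec k | offset-spec (suc k)
  ... | inj₁ (_ , e) | inj₁ (_ , e′) = +-cancelʳ-≡ P _ _ (trans e′ (cong suc (sym e)))
  ... | inj₂ (_ , e) | inj₂ (_ , e′) = +-cancelʳ-≡ P _ _ (trans e′ (cong suc (sym e)))
  ... | inj₁ (P<k , _) | inj₂ (1+k≤P , _) = ⊥-elim (<-irrefl refl (<-trans P<k 1+k≤P))
  ... | inj₂ (k≤P , _) | inj₁ (P<1+k , _) with m≤n⇒m<n∨m≡n k≤P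
  ...   | inj₂ k≡P = ⊥-elim (k≢P k≡P)
  ...   | inj₁ k<P with m≤n⇒m<n∨m≡n k<P
  ...     | inj₂ 1+k≡P = ⊥-elim (1+k≢P 1+k≡P)
  ...     | inj₁ 1+k<P = ⊥-elim (<-irrefl refl (<-trans P<1+k 1+k<P))

  offset-wrap : 2 + m ≢ P → offset 0 ≡ suc (offset (2 + m))
  offset-wrap last≢P with offset-spec 0 | offset-spec (2 + m)
  ... | inj₁ (() , _) | _
  ... | inj₂ (_ , e) | inj₁ (_ , e′) = +-cancelʳ-≡ P _ _ (trans e (cong suc (sym e′)))
  ... | inj₂ _ | inj₂ (last≤P , _) with m≤n⇒m<n∨m≡n last≤P
  ...   | inj₁ last<P = ⊥-elim (<-irrefl refl (≤-trans last<P P≤))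
  ...   | inj₂ last≡P = ⊥-elim (last≢P last≡P)

revCode : ℕ → ℕ
revCode c = foldCode (λ x acc → suc (pair x acc)) c 0

revCode-code : ∀ l → revCode (code l) ≡ code (reverse l)
revCode-code l = trans (foldCode-code _ l 0) (accumulate l [])
  where
  accumulate : ∀ l m → foldl (flip (λ x acc → suc (pair x acc))) (code m) l ≡ code (foldl (flip _∷_) m l)
  accumulate []      m = refl
  accumulate (x ∷ l) m = accumulate l (x ∷ m)

revCodeᴾ : ∀ {k} → Prog k → Prog k
revCodeᴾ = app₁ (withFun (compP (foldCodeᴾ consᴾ) (π₀ ∷ constᴾ 0 ∷ constᴾ 0 ∷ []))
                         (λ _ → unary revCode) (λ { o (c ∷ []) → foldCodeᴾ-fun consᴾ o c 0 0 }))
  where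
  consᴾ : Prog 3
  consᴾ = sucᴾ (pairᴾ π₀ π₁)

-- Component m consists of a cycle of length m+3 through the root ⟨m,1,0⟩ and
-- the gadget vertices ⟨m,0,j⟩ (j ≤ m+1), and of the tree T_m hanging from the
-- root: the node ⟨m,1,c⟩ stands for the sequence whose reverse has code c.
opaque
  vertex : ℕ → ℕ → ℕ → ℕ
  vertex m a b = pair m (pair a b)

component kind label : ℕ → ℕ
component u = pair₁ u
kind u = pair₁ (pair₂ u)
label u = pair₂ (pair₂ u)

opaque
  unfolding vertex

  vertex-parts : ∀ u → vertex (component u) (kind u) (label u) ≡ u
  vertex-parts u = trans (cong (pair (pair₁ u)) (pair-pair₁-pair₂ (pair₂ u))) (pair-pair₁-pair₂ u)

  component-vertex : ∀ m a b → component (vertex m a b) ≡ m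
  component-vertex m a b = pair₁-pair m (pair a b)

  kind-vertex : ∀ m a b → kind (vertex m a b) ≡ a
  kind-vertex m a b rewrite pair₂-pair m (pair a b) = pair₁-pair a b

  label-vertex : ∀ m a b → label (vertex m a b) ≡ b
  label-vertex m a b rewrite pair₂-pair m (pair a b) = pair₂-pair a b

  vertex-injective : ∀ {m a b m′ a′ b′} → vertex m a b ≡ vertex m′ a′ b′ → m ≡ m′ × a ≡ a′ × b ≡ b′
  vertex-injective eq with pair-injective eq
  ... | m≡m′ , rest with pair-injective rest
  ... | a≡a′ , b≡b′ = m≡m′ , a≡a′ , b≡b′

≡vertex : ∀ {u m a b} → component u ≡ m → kind u ≡ a → label u ≡ b → u ≡ vertex m a b
≡vertex {u} refl refl refl = sym (vertex-parts u)

vertex-≡ : ∀ {u v} → component u ≡ component v → kind u ≡ kind v → label u ≡ label v → u ≡ v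
vertex-≡ {v = v} c≡ k≡ l≡ = trans (≡vertex c≡ k≡ l≡) (vertex-parts v)

data Link (p : Baire) : ℕ → ℕ → ℕ → ℕ → ℕ → ℕ → Set where
  root-gadget   : ∀ {m} → Link p m 1 0 m 0 0
  gadget-gadget : ∀ {m j} → suc j ≤ suc m → Link p m 0 j m 0 (suc j)
  gadget-root   : ∀ {m} → Link p m 0 (suc m) m 1 0
  parent-child  : ∀ {m b d} → pair₂ d ≡ b → p (pair m (revCode (suc d))) ≡ 1 → Link p m 1 b m 1 (suc d)

rootGadgetℕ : ℕ → ℕ → ℕ → ℕ → ℕ
rootGadgetℕ a b a′ b′ = andℕ (eqℕ a 1) (andℕ (eqℕ b 0) (andℕ (eqℕ a′ 0) (eqℕ b′ 0)))

gadgetGadgetℕ : ℕ → ℕ → ℕ → ℕ → ℕ → ℕ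
gadgetGadgetℕ m a b a′ b′ = andℕ (eqℕ a 0) (andℕ (eqℕ a′ 0) (andℕ (eqℕ b′ (suc b)) (leℕ b′ (suc m))))

gadgetRootℕ : ℕ → ℕ → ℕ → ℕ → ℕ → ℕ
gadgetRootℕ m a b a′ b′ = andℕ (eqℕ a 0) (andℕ (eqℕ b (suc m)) (andℕ (eqℕ a′ 1) (eqℕ b′ 0)))

parentChildℕ : Baire → ℕ → ℕ → ℕ → ℕ → ℕ → ℕ
parentChildℕ p m a b a′ b′ =
  andℕ (eqℕ a 1) (andℕ (eqℕ a′ 1) (andℕ (isNonzero b′)
    (andℕ (eqℕ (pair₂ (pred b′)) b) (eqℕ (p (pair m (revCode b′))) 1))))

linkℕ : Baire → ℕ → ℕ → ℕ → ℕ → ℕ → ℕ → ℕ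
linkℕ p m a b m′ a′ b′ = andℕ (eqℕ m m′)
  (orℕ (rootGadgetℕ a b a′ b′) (orℕ (gadgetGadgetℕ m a b a′ b′)
    (orℕ (gadgetRootℕ m a b a′ b′) (parentChildℕ p m a b a′ b′))))

private
  andℕ-eqℕ≢0⇒ : ∀ {x y r} → andℕ (eqℕ x y) r ≢ 0 → x ≡ y × r ≢ 0
  andℕ-eqℕ≢0⇒ nz with andℕ≢0⇒ nz
  ... | eq≢0 , r≢0 = eqℕ≢0⇒≡ eq≢0 , r≢0

module _ {p : Baire} where

  rootGadgetℕ-sound : ∀ {m a b a′ b′} → rootGadgetℕ a b a′ b′ ≢ 0 → Link p m a b m a′ b′
  rootGadgetℕ-sound {a = a} {b} {a′} {b′} nz with andℕ-eqℕ≢0⇒ {a} {1} nz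
  ... | refl , nz₁ with andℕ-eqℕ≢0⇒ {b} {0} nz₁
  ... | refl , nz₂ with andℕ-eqℕ≢0⇒ {a′} {0} nz₂
  ... | refl , nz₃ with eqℕ≢0⇒≡ {b′} {0} nz₃
  ... | refl = root-gadget

  gadgetGadgetℕ-sound : ∀ {m a b a′ b′} → gadgetGadgetℕ m a b a′ b′ ≢ 0 → Link p m a b m a′ b′
  gadgetGadgetℕ-sound {m} {a} {b} {a′} {b′} nz with andℕ-eqℕ≢0⇒ {a} {0} nz
  ... | refl , nz₁ with andℕ-eqℕ≢0⇒ {a′} {0} nz₁
  ... | refl , nz₂ with andℕ-eqℕ≢0⇒ {b′} {suc b} nz₂
  ... | refl , nz₃ = gadget-gadget (leℕ≢0⇒≤ nz₃)

  gadgetRootℕ-sound : ∀ {m a b a′ b′} → gadgetRootℕ m a b a′ b′ ≢ 0 → Link p m a b m a′ b′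
  gadgetRootℕ-sound {m} {a} {b} {a′} {b′} nz with andℕ-eqℕ≢0⇒ {a} {0} nz
  ... | refl , nz₁ with andℕ-eqℕ≢0⇒ {b} {suc m} nz₁
  ... | refl , nz₂ with andℕ-eqℕ≢0⇒ {a′} {1} nz₂
  ... | refl , nz₃ with eqℕ≢0⇒≡ {b′} {0} nz₃
  ... | refl = gadget-root

  parentChildℕ-sound : ∀ {m a b a′ b′} → parentChildℕ p m a b a′ b′ ≢ 0 → Link p m a b m a′ b′
  parentChildℕ-sound {a = a} {a′ = a′} {zero} nz with andℕ-eqℕ≢0⇒ {a} {1} nz
  ... | refl , nz₁ with andℕ-eqℕ≢0⇒ {a′} {1} nz₁
  ... | refl , nz₂ = ⊥-elim (nz₂ refl)
  parentChildℕ-sound {m} {a} {b} {a′} {suc d} nz with andℕ-eqℕ≢0⇒ {a} {1} nz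
  ... | refl , nz₁ with andℕ-eqℕ≢0⇒ {a′} {1} nz₁
  ... | refl , nz₂ with andℕ-eqℕ≢0⇒ {pair₂ d} {b} nz₂
  ... | parent , nz₃ = parent-child parent (eqℕ≢0⇒≡ nz₃)

linkℕ-sound : ∀ {p m a b m′ a′ b′} → linkℕ p m a b m′ a′ b′ ≢ 0 → Link p m a b m′ a′ b′
linkℕ-sound {m = m} {m′ = m′} nz with andℕ-eqℕ≢0⇒ {m} {m′} nz
... | refl , nz₁ with orℕ≢0⇒ nz₁
... | inj₁ nz₂ = rootGadgetℕ-sound nz₂
... | inj₂ nz₂ with orℕ≢0⇒ nz₂
...   | inj₁ nz₃ = gadgetGadgetℕ-sound nz₃
...   | inj₂ nz₃ with orℕ≢0⇒ nz₃
...     | inj₁ nz₄ = gadgetRootℕ-sound nz₄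
...     | inj₂ nz₄ = parentChildℕ-sound nz₄

linkℕ-complete : ∀ {p m a b m′ a′ b′} → Link p m a b m′ a′ b′ → linkℕ p m a b m′ a′ b′ ≡ 1
linkℕ-complete {m = m} root-gadget rewrite eqℕ-refl m = refl
linkℕ-complete {m = m} (gadget-gadget {j = j} j<) rewrite eqℕ-refl m | eqℕ-refl j | ≤⇒leℕ≡1 j< = refl
linkℕ-complete {m = m} gadget-root rewrite eqℕ-refl m = refl
linkℕ-complete {m = m} {b = b} (parent-child {d = d} refl inTree)
  rewrite eqℕ-refl m | eqℕ-refl (pair₂ d) | inTree = orℕ-≡1ʳ (andℕ (eqℕ b 0) 0) (orℕ-≡1ʳ 0 (orℕ-≡1ʳ 0 refl))

Linked : Baire → ℕ → ℕ → Set
Linked p u v = Link p (component u) (kind u) (label u) (component v) (kind v) (label v)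

Adjacent : Baire → ℕ → ℕ → Set
Adjacent p u v = Linked p u v ⊎ Linked p v u

linkedℕ : Baire → ℕ → ℕ → ℕ
linkedℕ p u v = linkℕ p (component u) (kind u) (label u) (component v) (kind v) (label v)

treeGraph : Baire → Baire
treeGraph p k = isNonzero (orℕ (linkedℕ p (pair₁ k) (pair₂ k)) (linkedℕ p (pair₂ k) (pair₁ k)))

treeGraphProg : Prog 1
treeGraphProg = compP adjacentᴾ (pair₁ᴾ π₀ ∷ pair₂ᴾ π₀ ∷ [])
  where
  linkedᴾ : Prog 2
  linkedᴾ = andᴾ (eqᴾ m m′) (orᴾ rootGadget (orᴾ gadgetGadget (orᴾ gadgetRoot parentChild)))
    where
    m a b m′ a′ b′ : Prog 2
    m  = pair₁ᴾ π₀
    a  = pair₁ᴾ (pair₂ᴾ π₀)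
    b  = pair₂ᴾ (pair₂ᴾ π₀)
    m′ = pair₁ᴾ π₁
    a′ = pair₁ᴾ (pair₂ᴾ π₁)
    b′ = pair₂ᴾ (pair₂ᴾ π₁)
    rootGadget gadgetGadget gadgetRoot parentChild : Prog 2
    rootGadget =
      andᴾ (eqᴾ a (constᴾ 1)) (andᴾ (eqᴾ b (constᴾ 0)) (andᴾ (eqᴾ a′ (constᴾ 0)) (eqᴾ b′ (constᴾ 0))))
    gadgetGadget =
      andᴾ (eqᴾ a (constᴾ 0)) (andᴾ (eqᴾ a′ (constᴾ 0)) (andᴾ (eqᴾ b′ (sucᴾ b)) (leᴾ b′ (sucᴾ m))))
    gadgetRoot =
      andᴾ (eqᴾ a (constᴾ 0)) (andᴾ (eqᴾ b (sucᴾ m)) (andᴾ (eqᴾ a′ (constᴾ 1)) (eqᴾ b′ (constᴾ 0))))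
    parentChild = andᴾ (eqᴾ a (constᴾ 1)) (andᴾ (eqᴾ a′ (constᴾ 1)) (andᴾ (isZeroᴾ (isZeroᴾ b′))
                    (andᴾ (eqᴾ (pair₂ᴾ (predᴾ b′)) b)
                          (eqᴾ (app₁ oracleP (pairᴾ m (revCodeᴾ b′))) (constᴾ 1)))))
  adjacentᴾ : Prog 2
  adjacentᴾ = isZeroᴾ (isZeroᴾ (orᴾ linkedᴾ (compP linkedᴾ (π₁ ∷ π₀ ∷ []))))

treeGraphProg-computes : ∀ p → Computes (term treeGraphProg) p (treeGraph p)
treeGraphProg-computes = computes treeGraphProg

edge⇒adjacent : ∀ {p u v} → Edge (treeGraph p) u v → Adjacent p u v
edge⇒adjacent {p} {u} {v} e rewrite pair₁-pair u v | pair₂-pair u v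
  with orℕ≢0⇒ (isNonzero≢0⇒ (≡1⇒≢0 e))
... | inj₁ nz = inj₁ (linkℕ-sound nz)
... | inj₂ nz = inj₂ (linkℕ-sound nz)

adjacent⇒edge : ∀ {p u v} → Adjacent p u v → Edge (treeGraph p) u v
adjacent⇒edge {p} {u} {v} adj rewrite pair₁-pair u v | pair₂-pair u v = ≢0⇒isNonzero≡1 (≡1⇒≢0 (or≡1 adj))
  where
  or≡1 : Adjacent p u v → orℕ (linkedℕ p u v) (linkedℕ p v u) ≡ 1
  or≡1 (inj₁ l) = orℕ-≡1ˡ (linkedℕ p v u) (linkℕ-complete l)
  or≡1 (inj₂ l) = orℕ-≡1ʳ (linkedℕ p u v) (linkℕ-complete l)

link⇒adjacent : ∀ {p m a b m′ a′ b′} → Link p m a b m′ a′ b′ → Adjacent p (vertex m a b) (vertex m′ a′ b′)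
link⇒adjacent {m = m} {a} {b} {m′} {a′} {b′} l
  rewrite component-vertex m a b | kind-vertex m a b | label-vertex m a b
        | component-vertex m′ a′ b′ | kind-vertex m′ a′ b′ | label-vertex m′ a′ b′ = inj₁ l

link⇒edge : ∀ {p m a b m′ a′ b′} → Link p m a b m′ a′ b′ →
            Edge (treeGraph p) (vertex m a b) (vertex m′ a′ b′)
link⇒edge {p} {m} {a} {b} {m′} {a′} {b′} l = adjacent⇒edge {p} {vertex m a b} {vertex m′ a′ b′} (link⇒adjacent l)

Adjacent-sym : ∀ {p u v} → Adjacent p u v → Adjacent p v u
Adjacent-sym (inj₁ l) = inj₂ l
Adjacent-sym (inj₂ l) = inj₁ l

Link-irrefl : ∀ {p m a b} → ¬ Link p m a b m a b
Link-irrefl (parent-child {d = d} child _) = <-irrefl refl (subst (_≤ d) child (pair₂≤ d))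

Adjacent-irrefl : ∀ {p u} → ¬ Adjacent p u u
Adjacent-irrefl (inj₁ l) = Link-irrefl l
Adjacent-irrefl (inj₂ l) = Link-irrefl l

treeGraph-isGraph : ∀ p → IsGraph (treeGraph p)
treeGraph-isGraph p = (λ k → isNonzero≤1 _)
                    , (λ u v e → adjacent⇒edge {p} {v} {u} (Adjacent-sym (edge⇒adjacent {p} {u} {v} e)))
                    , (λ u e → Adjacent-irrefl (edge⇒adjacent {p} {u} {u} e))

path⇒subgraph : ∀ p n → HasPath p n → SubgraphL n (treeGraph p)
path⇒subgraph p n (h , onPath) = embed , (λ {a} {b} → embed-injective a b) , embed-edge
  where
  embed : LV n → ℕ
  embed (inj₁ k) = vertex n 1 (code (revPrefix h k))
  embed (inj₂ j) = vertex n 0 (toℕ j)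

  embed-injective : ∀ a b → embed a ≡ embed b → a ≡ b
  embed-injective (inj₁ i) (inj₁ j) eq = cong inj₁ (begin
    i                          ≡⟨ length-revPrefix h i ⟨
    length (revPrefix h i)     ≡⟨ cong length (code-injective (proj₂ (proj₂ (vertex-injective eq)))) ⟩
    length (revPrefix h j)     ≡⟨ length-revPrefix h j ⟩
    j                          ∎)
    where open ≡-Reasoning
  embed-injective (inj₁ i) (inj₂ j) eq with proj₁ (proj₂ (vertex-injective eq))
  ... | ()
  embed-injective (inj₂ i) (inj₁ j) eq with proj₁ (proj₂ (vertex-injective eq))
  ... | ()
  embed-injective (inj₂ i) (inj₂ j) eq = cong inj₂ (toℕ-injective (proj₂ (proj₂ (vertex-injective eq))))

  inTree : ∀ k → p (pair n (revCode (code (revPrefix h (suc k))))) ≡ 1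
  inTree k rewrite revCode-code (revPrefix h (suc k)) | reverse-revPrefix h (suc k) = onPath (suc k)

  embed-edge : ∀ a b → LE n a b → Edge (treeGraph p) (embed a) (embed b)
  embed-edge _ _ (path i) = link⇒edge {p} (parent-child (pair₂-pair (h i) (code (revPrefix h i))) (inTree i))
  embed-edge _ _ cycStart = link⇒edge {p} root-gadget
  embed-edge _ _ (cyc j) rewrite toℕ-inject₁ j = link⇒edge {p} (gadget-gadget (toℕ<n j))
  embed-edge _ _ cycEnd rewrite toℕ-fromℕ n = link⇒edge {p} gadget-root

Link-component : ∀ {p m a b m′ a′ b′} → Link p m a b m′ a′ b′ → m ≡ m′
Link-component root-gadget        = refl
Link-component (gadget-gadget _)  = refl
Link-component gadget-root        = refl
Link-component (parent-child _ _) = refl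

Adjacent-component : ∀ {p} u v → Adjacent p u v → component u ≡ component v
Adjacent-component u v (inj₁ l) = Link-component l
Adjacent-component u v (inj₂ l) = sym (Link-component l)

treePotentialℕ : ℕ → ℕ → ℕ
treePotentialℕ 1 b = b
treePotentialℕ _ b = 0

treePotential : ℕ → ℕ
treePotential u = treePotentialℕ (kind u) (label u)

link-into-node : ∀ {p m a b m′ a′ b′ d} → Link p m a b m′ a′ b′ → a′ ≡ 1 → b′ ≡ suc d →
                 m ≡ m′ × a ≡ 1 × b ≡ pair₂ d
link-into-node (parent-child parent _) refl refl = refl , refl , sym parent

-- Children carry larger labels than their parents, so the only neighbour of a
-- tree node that is not above it in potential is its parent.
link-below-node : ∀ {p m a b m′ a′ b′ d} → a′ ≡ 1 → b′ ≡ suc d →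
  Link p m a b m′ a′ b′ ⊎ Link p m′ a′ b′ m a b → treePotentialℕ a b ≤ suc d →
  m ≡ m′ × a ≡ 1 × b ≡ pair₂ d
link-below-node a′≡1 b′≡ (inj₁ l) _ = link-into-node l a′≡1 b′≡
link-below-node refl refl (inj₂ (parent-child {d = d′} parent _)) b≤ =
  ⊥-elim (<-irrefl refl (≤-trans (s≤s (subst (_≤ d′) parent (pair₂≤ d′))) b≤))

treePotential-positive : ∀ {a b} → 0 < treePotentialℕ a b → a ≡ 1 × Σ ℕ λ d → b ≡ suc d
treePotential-positive {1} {suc d} _ = refl , d , refl

treePotential-atMostOneLower : ∀ {p} → AtMostOneLowerNeighbour (Adjacent p) treePotential
treePotential-atMostOneLower {p} u v v′ vu uv′ v≤ v′≤ u>0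
  with treePotential-positive {kind u} {label u} u>0
... | kind≡1 , d , label≡ = trans (parent v vu v≤) (sym (parent v′ (Adjacent-sym uv′) v′≤))
  where
  parent : ∀ x → Adjacent p x u → treePotential x ≤ treePotential u → x ≡ vertex (component u) 1 (pair₂ d)
  parent x xu x≤
    with link-below-node kind≡1 label≡ xu (subst (treePotential x ≤_) (cong₂ treePotentialℕ kind≡1 label≡) x≤)
  ... | c , k , l = ≡vertex c k l

record IsChild (p : Baire) (m b a′ b′ : ℕ) : Set where
  field
    kind≡1    : a′ ≡ 1
    predLabel : ℕ
    label≡    : b′ ≡ suc predLabel
    parent≡   : pair₂ predLabel ≡ b
    inTree    : p (pair m (revCode (suc predLabel))) ≡ 1

isChild : ∀ {p m b d} → pair₂ d ≡ b → p (pair m (revCode (suc d))) ≡ 1 → IsChild p m b 1 (suc d)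
isChild parent inTree = record { kind≡1 = refl ; predLabel = _ ; label≡ = refl ; parent≡ = parent ; inTree = inTree }

link-from-node : ∀ {p m a b m′ a′ b′ d} → Link p m a b m′ a′ b′ → a ≡ 1 → b ≡ suc d →
                 m ≡ m′ × IsChild p m b a′ b′
link-from-node (parent-child parent inTree) refl refl = refl , isChild parent inTree

data OnCycle (m : ℕ) : ℕ → ℕ → Set where
  root   : OnCycle m 1 0
  gadget : ∀ {j} → j ≤ suc m → OnCycle m 0 j

CycleVertex : ℕ → ℕ → Set
CycleVertex m u = component u ≡ m × OnCycle m (kind u) (label u)

link-out-of-cycle : ∀ {p m a b m′ a′ b′} → Link p m a b m′ a′ b′ → OnCycle m a b →
                    OnCycle m a′ b′ ⊎ (a ≡ 1 × b ≡ 0 × IsChild p m 0 a′ b′)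
link-out-of-cycle root-gadget         _    = inj₁ (gadget z≤n)
link-out-of-cycle (gadget-gadget j<)  _    = inj₁ (gadget j<)
link-out-of-cycle gadget-root         _    = inj₁ root
link-out-of-cycle (parent-child parent inTree) root = inj₂ (refl , refl , isChild parent inTree)

link-into-cycle : ∀ {p m a b m′ a′ b′} → Link p m a b m′ a′ b′ → OnCycle m′ a′ b′ → OnCycle m a b
link-into-cycle root-gadget        _ = root
link-into-cycle (gadget-gadget j<) _ = gadget (≤-trans (n≤1+n _) j<)
link-into-cycle gadget-root        _ = gadget ≤-refl

link-from-potential-zero : ∀ {p m a b m′ a′ b′} → Link p m a b m′ a′ b′ →
                           treePotentialℕ a b ≡ 0 → OnCycle m a b
link-from-potential-zero root-gadget        _    = root
link-from-potential-zero (gadget-gadget j<) _    = gadget (≤-trans (n≤1+n _) j<)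
link-from-potential-zero gadget-root        _    = gadget ≤-refl
link-from-potential-zero (parent-child _ _) refl = root

link-to-potential-zero : ∀ {p m a b m′ a′ b′} → Link p m a b m′ a′ b′ →
                         treePotentialℕ a′ b′ ≡ 0 → OnCycle m′ a′ b′
link-to-potential-zero root-gadget        _ = gadget z≤n
link-to-potential-zero (gadget-gadget j<) _ = gadget j<
link-to-potential-zero gadget-root        _ = root

potential-zero⇒cycleVertex : ∀ {p} u v → Adjacent p u v → treePotential u ≡ 0 → CycleVertex (component u) u
potential-zero⇒cycleVertex u v (inj₁ l) φu≡0 = refl , link-from-potential-zero l φu≡0
potential-zero⇒cycleVertex u v (inj₂ l) φu≡0 = refl , link-to-potential-zero l φu≡0

cyclePositionℕ : ℕ → ℕ → ℕ
cyclePositionℕ 1 b = 0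
cyclePositionℕ _ b = suc b

cyclePosition : ℕ → ℕ
cyclePosition u = cyclePositionℕ (kind u) (label u)

cyclePositionℕ≤ : ∀ {m a b} → OnCycle m a b → cyclePositionℕ a b ≤ 2 + m
cyclePositionℕ≤ root       = z≤n
cyclePositionℕ≤ (gadget j≤) = s≤s j≤

cyclePosition≤ : ∀ {m u} → CycleVertex m u → cyclePosition u ≤ 2 + m
cyclePosition≤ (_ , onCycle) = cyclePositionℕ≤ onCycle

cyclePositionℕ-injective : ∀ {m a b m′ a′ b′} → OnCycle m a b → OnCycle m′ a′ b′ →
                           cyclePositionℕ a b ≡ cyclePositionℕ a′ b′ → a ≡ a′ × b ≡ b′
cyclePositionℕ-injective root       root       _  = refl , refl
cyclePositionℕ-injective (gadget _) (gadget _) eq = refl , suc-injective eq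

cyclePosition-injective : ∀ {m u v} → CycleVertex m u → CycleVertex m v → cyclePosition u ≡ cyclePosition v → u ≡ v
cyclePosition-injective (cu , onU) (cv , onV) eq with cyclePositionℕ-injective onU onV eq
... | k≡ , l≡ = vertex-≡ (trans cu (sym cv)) k≡ l≡

data NextOnCycle (m : ℕ) : ℕ → ℕ → Set where
  step : ∀ {k} → NextOnCycle m k (suc k)
  wrap : NextOnCycle m (2 + m) 0

link-next : ∀ {p m a b m′ a′ b′} → Link p m a b m′ a′ b′ → OnCycle m′ a′ b′ →
            NextOnCycle m (cyclePositionℕ a b) (cyclePositionℕ a′ b′)
link-next root-gadget       _ = step
link-next (gadget-gadget _) _ = step
link-next gadget-root       _ = wrap

adjacent-next : ∀ {p m} u v → Adjacent p u v → CycleVertex m u → CycleVertex m v →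
  NextOnCycle m (cyclePosition u) (cyclePosition v) ⊎ NextOnCycle m (cyclePosition v) (cyclePosition u)
adjacent-next u v (inj₁ l) (refl , _) (cv , onV) = inj₁ (link-next l (subst (λ m → OnCycle m _ _) (sym cv) onV))
adjacent-next u v (inj₂ l) (cu , onU) (refl , _) = inj₂ (link-next l (subst (λ m → OnCycle m _ _) (sym cu) onU))

module EmbeddingInTreeGraph (p : Baire) (n : ℕ) (f : LV n → ℕ) (f-injective : Injective _≡_ _≡_ f)
                            (f-edge : ∀ a b → LE n a b → Edge (treeGraph p) (f a) (f b)) where

  adjacent : ∀ {a b} → LE n a b → Adjacent p (f a) (f b)
  adjacent {a} {b} l = edge⇒adjacent {p} {f a} {f b} (f-edge a b l)

  -- The cycle of L_n read from v₀, so that indices 0 and 3+n both give v₀.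
  cycleIndex : ℕ → LV n
  cycleIndex zero = inj₁ 0
  cycleIndex (suc i) with i <? 2 + n
  ... | yes i< = inj₂ (fromℕ< i<)
  ... | no  _  = inj₁ 0

  cycle : ℕ → ℕ
  cycle i = f (cycleIndex i)

  cycleIndex-gadget : ∀ i (i< : i < 2 + n) → cycleIndex (suc i) ≡ inj₂ (fromℕ< i<)
  cycleIndex-gadget i i< with i <? 2 + n
  ... | yes _  = refl
  ... | no  i≮ = ⊥-elim (i≮ i<)

  cycleIndex-end : cycleIndex (3 + n) ≡ inj₁ 0
  cycleIndex-end with 2 + n <? 2 + n
  ... | yes n< = ⊥-elim (<-irrefl refl n<)
  ... | no  _  = refl

  cycle-closed : cycle (3 + n) ≡ cycle 0
  cycle-closed = cong f cycleIndex-end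

  cycle-step : ∀ i → i < 3 + n → Adjacent p (cycle i) (cycle (suc i))
  cycle-step zero _ rewrite cycleIndex-gadget 0 (s≤s z≤n) = adjacent cycStart
  cycle-step (suc j) (s≤s j<) with m≤n⇒m<n∨m≡n (≤-pred j<)
  ... | inj₁ j<n+1 rewrite cycleIndex-gadget j j< | cycleIndex-gadget (suc j) (s≤s j<n+1) =
    subst (λ c → Adjacent p (f (inj₂ c)) (f (inj₂ (Fin.suc (fromℕ< j<n+1)))))
          (inject₁-fromℕ< j<n+1 j<) (adjacent (cyc (fromℕ< j<n+1)))
  ... | inj₂ refl rewrite cycleIndex-gadget (suc n) j< | cycleIndex-end =
    subst (λ c → Adjacent p (f (inj₂ c)) (f (inj₁ 0))) (fromℕ≡fromℕ< j<) (adjacent cycEnd)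

  cycleIndex-injective : ∀ i j → i < 3 + n → j < 3 + n → cycleIndex i ≡ cycleIndex j → i ≡ j
  cycleIndex-injective zero    zero    _        _        _  = refl
  cycleIndex-injective zero    (suc j) _        (s≤s j<) eq with trans eq (cycleIndex-gadget j j<)
  ... | ()
  cycleIndex-injective (suc i) zero    (s≤s i<) _        eq with trans (sym eq) (cycleIndex-gadget i i<)
  ... | ()
  cycleIndex-injective (suc i) (suc j) (s≤s i<) (s≤s j<) eq = cong suc (begin
    i                 ≡⟨ toℕ-fromℕ< i< ⟨
    toℕ (fromℕ< i<)   ≡⟨ cong toℕ (inj₂-injective
                           (trans (sym (cycleIndex-gadget i i<)) (trans eq (cycleIndex-gadget j j<)))) ⟩
    toℕ (fromℕ< j<)   ≡⟨ toℕ-fromℕ< j< ⟩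
    j                 ∎)
    where
    open ≡-Reasoning
    inj₂-injective : ∀ {x y : Fin (2 + n)} → inj₂ {A = ℕ} x ≡ inj₂ y → x ≡ y
    inj₂-injective refl = refl

  cycle-injective : ∀ i j → i < 3 + n → j < 3 + n → cycle i ≡ cycle j → i ≡ j
  cycle-injective i j i< j< eq = cycleIndex-injective i j i< j< (f-injective eq)

  m₀ : ℕ
  m₀ = component (cycle 0)

  cycle-component : ∀ i → i ≤ 3 + n → component (cycle i) ≡ m₀
  cycle-component zero    _  = refl
  cycle-component (suc i) i< =
    trans (sym (Adjacent-component (cycle i) (cycle (suc i)) (cycle-step i i<))) (cycle-component i (<⇒≤ i<))

  cycle-cycleVertex : ∀ i → i < 3 + n → CycleVertex m₀ (cycle i)
  cycle-cycleVertex i i< =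
    subst (λ m → CycleVertex m (cycle i)) (cycle-component i (<⇒≤ i<))
          (potential-zero⇒cycleVertex (cycle i) (cycle (suc i)) (cycle-step i i<) (potential-zero i i<))
    where
    potential-zero : ∀ i → i < 3 + n → treePotential (cycle i) ≡ 0
    potential-zero = potential-vanishes-on-cycle (Adjacent p) cycle n cycle-closed cycle-step
                       treePotential cycle-injective treePotential-atMostOneLower

  cycle-cycleVertex≤ : ∀ i → i ≤ 3 + n → CycleVertex m₀ (cycle i)
  cycle-cycleVertex≤ i i≤ with m≤n⇒m<n∨m≡n i≤
  ... | inj₁ i<   = cycle-cycleVertex i i<
  ... | inj₂ refl = subst (CycleVertex m₀) (sym cycle-closed) (cycle-cycleVertex 0 (s≤s z≤n))

  -- Were position P missed, the offset from P would be a potential on the cycle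
  -- with at most one lower neighbour everywhere, yet it never vanishes.
  module _ (P : ℕ) (P≤ : P ≤ 2 + m₀) (missed : ∀ i → i < 3 + n → cyclePosition (cycle i) ≢ P) where
    open CycleOffset m₀ P P≤

    φ : ℕ → ℕ
    φ u = offset (cyclePosition u)

    AvoidingP : ℕ → ℕ → Set
    AvoidingP u v = Adjacent p u v × CycleVertex m₀ u × CycleVertex m₀ v × cyclePosition u ≢ P × cyclePosition v ≢ P

    missed≤ : ∀ i → i ≤ 3 + n → cyclePosition (cycle i) ≢ P
    missed≤ i i≤ with m≤n⇒m<n∨m≡n i≤
    ... | inj₁ i<   = missed i i<
    ... | inj₂ refl = subst (λ u → cyclePosition u ≢ P) (sym cycle-closed) (missed 0 (s≤s z≤n))

    offset-next : ∀ {k k′} → NextOnCycle m₀ k k′ → k ≢ P → k′ ≢ P → offset k′ ≡ suc (offset k)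
    offset-next step k≢P k′≢P = offset-suc _ k≢P k′≢P
    offset-next wrap k≢P _    = offset-wrap k≢P

    φ-neighbour : ∀ {u v} → AvoidingP u v → φ v ≡ suc (φ u) ⊎ φ u ≡ suc (φ v)
    φ-neighbour {u} {v} (uv , cu , cv , u≢P , v≢P) with adjacent-next u v uv cu cv
    ... | inj₁ next = inj₁ (offset-next next u≢P v≢P)
    ... | inj₂ next = inj₂ (offset-next next v≢P u≢P)

    φ-atMostOneLower : AtMostOneLowerNeighbour AvoidingP φ
    φ-atMostOneLower u v v′ vu uv′ v≤ v′≤ _ =
      cyclePosition-injective (proj₁ (proj₂ vu)) (proj₁ (proj₂ (proj₂ uv′)))
        (offset-injective _ _ (cyclePosition≤ (proj₁ (proj₂ vu))) (cyclePosition≤ (proj₁ (proj₂ (proj₂ uv′))))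
          (suc-injective (trans (sym (above v vu v≤)) (above v′ (swap uv′) v′≤))))
      where
      swap : ∀ {x y} → AvoidingP x y → AvoidingP y x
      swap (xy , cx , cy , x≢P , y≢P) = Adjacent-sym xy , cy , cx , y≢P , x≢P
      above : ∀ x → AvoidingP x u → φ x ≤ φ u → φ u ≡ suc (φ x)
      above x xu x≤ with φ-neighbour xu
      ... | inj₁ up   = up
      ... | inj₂ down = ⊥-elim (<-irrefl refl (≤-trans (≤-reflexive (sym down)) x≤))

    position-missed-absurd : ⊥
    position-missed-absurd = <-irrefl (sym φ≡0) (offset-positive (cyclePosition (cycle 0)))
      where
      φ≡0 : φ (cycle 0) ≡ 0
      φ≡0 = potential-vanishes-on-cycle AvoidingP cycle n cycle-closed
              (λ i i< → cycle-step i i< , cycle-cycleVertex i i< , cycle-cycleVertex≤ (suc i) i<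
                      , missed i i< , missed≤ (suc i) i<)
              φ cycle-injective φ-atMostOneLower 0 (s≤s z≤n)

  cycle-covers : ∀ P → P ≤ 2 + m₀ → Σ ℕ λ i → i < 3 + n × cyclePosition (cycle i) ≡ P
  cycle-covers P P≤ with anyUpTo? (λ i → cyclePosition (cycle i) ≟ P) (3 + n)
  ... | yes found = found
  ... | no  none  = ⊥-elim (position-missed-absurd P P≤ (λ i i< hit → none (i , i< , hit)))

  n≡m₀ : n ≡ m₀
  n≡m₀ = suc-injective (suc-injective (suc-injective
           (cantor-schröder-bernstein {f = position} {g = visitor} position-injective visitor-injective)))
    where
    position : Fin (3 + n) → Fin (3 + m₀)
    position i = fromℕ< (s≤s (cyclePosition≤ (cycle-cycleVertex (toℕ i) (toℕ<n i))))

    position-injective : Injective _≡_ _≡_ position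
    position-injective {i} {j} eq = toℕ-injective (cycle-injective (toℕ i) (toℕ j) (toℕ<n i) (toℕ<n j)
      (cyclePosition-injective (cycle-cycleVertex (toℕ i) (toℕ<n i)) (cycle-cycleVertex (toℕ j) (toℕ<n j))
        (trans (sym (toℕ-fromℕ< _)) (trans (cong toℕ eq) (toℕ-fromℕ< _)))))

    visit : (P : Fin (3 + m₀)) → Σ ℕ λ i → i < 3 + n × cyclePosition (cycle i) ≡ toℕ P
    visit P = cycle-covers (toℕ P) (≤-pred (toℕ<n P))

    visitor : Fin (3 + m₀) → Fin (3 + n)
    visitor P = fromℕ< (proj₁ (proj₂ (visit P)))

    visitor-injective : Injective _≡_ _≡_ visitor
    visitor-injective {P} {Q} eq = toℕ-injective (begin
      toℕ P                                   ≡⟨ proj₂ (proj₂ (visit P)) ⟨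
      cyclePosition (cycle (proj₁ (visit P))) ≡⟨ cong (λ i → cyclePosition (cycle i)) same-index ⟩
      cyclePosition (cycle (proj₁ (visit Q))) ≡⟨ proj₂ (proj₂ (visit Q)) ⟩
      toℕ Q                                   ∎)
      where
      open ≡-Reasoning
      same-index : proj₁ (visit P) ≡ proj₁ (visit Q)
      same-index = trans (sym (toℕ-fromℕ< _)) (trans (cong toℕ eq) (toℕ-fromℕ< _))

  ray : ℕ → ℕ
  ray k = f (inj₁ k)

  ray₁-offCycle : ¬ CycleVertex m₀ (ray 1)
  ray₁-offCycle onCycle with cycle-covers (cyclePosition (ray 1)) (cyclePosition≤ onCycle)
  ... | i , i< , hit = not-ray₁ i i< (f-injective (cyclePosition-injective (cycle-cycleVertex i i<) onCycle hit))
    where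
    not-ray₁ : ∀ i → i < 3 + n → cycleIndex i ≢ inj₁ 1
    not-ray₁ zero    _        ()
    not-ray₁ (suc i) (s≤s i<) eq with trans (sym (cycleIndex-gadget i i<)) eq
    ... | ()

  record RayStep (k : ℕ) : Set where
    field
      parent-component : component (ray k) ≡ m₀
      parent-kind      : kind (ray k) ≡ 1
      child-component  : component (ray (suc k)) ≡ m₀
      child            : IsChild p m₀ (label (ray k)) (kind (ray (suc k))) (label (ray (suc k)))

  ray-first : label (ray 0) ≡ 0 × RayStep 0
  ray-first with adjacent {inj₁ 0} {inj₁ 1} (path 0) | cycle-cycleVertex 0 (s≤s z≤n)
  ... | inj₁ l | _ , onCycle with link-out-of-cycle l onCycle
  ...   | inj₁ onCycle′ = ⊥-elim (ray₁-offCycle (sym (Link-component l) , onCycle′))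
  ...   | inj₂ (kind≡1 , label≡0 , child) = label≡0 , record
    { parent-component = refl ; parent-kind = kind≡1 ; child-component = sym (Link-component l)
    ; child = subst (λ b → IsChild p m₀ b (kind (ray 1)) (label (ray 1))) (sym label≡0) child }
  ray-first | inj₂ l | _ , onCycle =
    ⊥-elim (ray₁-offCycle (Link-component l , subst (λ m → OnCycle m (kind (ray 1)) (label (ray 1))) (Link-component l)
                                                        (link-into-cycle l onCycle)))

  -- The ray cannot turn back to the parent (f is injective), so it keeps descending.
  ray-extend : ∀ k → RayStep k → RayStep (suc k)
  ray-extend k s = continue (adjacent (path (suc k)))
    where
    open RayStep s
    open IsChild child
    continue : Adjacent p (ray (suc k)) (ray (suc (suc k))) → RayStep (suc k)
    continue (inj₁ l) with link-from-node l kind≡1 label≡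
    ... | c≡ , child′ = record
      { parent-component = child-component ; parent-kind = kind≡1
      ; child-component = trans (sym c≡) child-component
      ; child = subst (λ m → IsChild p m (label (ray (suc k))) (kind (ray (2 + k))) (label (ray (2 + k))))
                      child-component child′ }
    continue (inj₂ l) with link-into-node l kind≡1 label≡
    ... | c≡ , k≡ , l≡ = ⊥-elim (backtrack (f-injective (vertex-≡
          (trans c≡ (trans child-component (sym parent-component))) (trans k≡ (sym parent-kind)) (trans l≡ parent≡))))
      where
      backtrack : inj₁ (suc (suc k)) ≢ inj₁ {B = Fin (2 + n)} k
      backtrack ()

  ray-step : ∀ k → RayStep k
  ray-step zero    = proj₂ ray-first
  ray-step (suc k) = ray-extend k (ray-step k)

  ray-path : Baire
  ray-path k = pair₁ (IsChild.predLabel (RayStep.child (ray-step k)))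

  label-ray : ∀ k → label (ray k) ≡ code (revPrefix ray-path k)
  label-ray zero    = proj₁ ray-first
  label-ray (suc k) = begin
    label (ray (suc k))                                 ≡⟨ label≡ ⟩
    suc predLabel                                       ≡⟨ cong suc (pair-pair₁-pair₂ predLabel) ⟨
    suc (pair (ray-path k) (pair₂ predLabel))           ≡⟨ cong (λ c → suc (pair (ray-path k) c))
                                                                (trans parent≡ (label-ray k)) ⟩
    suc (pair (ray-path k) (code (revPrefix ray-path k))) ∎
    where
    open ≡-Reasoning
    open IsChild (RayStep.child (ray-step k))

  ray-path-inTree : ∀ k → InTree p n (map ray-path (upTo (suc k)))
  ray-path-inTree k = subst₂ (λ m c → p (pair m c) ≡ 1) (sym n≡m₀) revCode≡ inTree
    where
    open IsChild (RayStep.child (ray-step k))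
    revCode≡ : revCode (suc predLabel) ≡ code (map ray-path (upTo (suc k)))
    revCode≡ = begin
      revCode (suc predLabel)                         ≡⟨ cong revCode (trans (sym label≡) (label-ray (suc k))) ⟩
      revCode (code (revPrefix ray-path (suc k)))     ≡⟨ revCode-code (revPrefix ray-path (suc k)) ⟩
      code (reverse (revPrefix ray-path (suc k)))     ≡⟨ cong code (reverse-revPrefix ray-path (suc k)) ⟩
      code (map ray-path (upTo (suc k)))              ∎
      where open ≡-Reasoning

  hasPath : IsTreeSeq p → HasPath p n
  hasPath (_ , prefix-closed) = ray-path , λ
    { zero    → prefix-closed n [] (ray-path 0) (ray-path-inTree 0)
    ; (suc k) → ray-path-inTree k }

subgraph⇒path : ∀ p n → IsTreeSeq p → SubgraphL n (treeGraph p) → HasPath p n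
subgraph⇒path p n trees (f , f-injective , f-edge) = EmbeddingInTreeGraph.hasPath p n f f-injective f-edge trees

absentStep : ℕ → ℕ → ℕ → ℕ
absentStep x y acc = andℕ acc (isZero (eqℕ y x))

absentℕ : ℕ → ℕ → ℕ
absentℕ x c = foldCode (absentStep x) c 1

absentᴾ : ∀ {k} → Prog k → Prog k → Prog k
absentᴾ = app₂ (withFun (compP (foldCodeᴾ stepᴾ) (π₁ ∷ constᴾ 1 ∷ π₀ ∷ [])) (λ _ → binary absentℕ)
                        (λ { o (x ∷ c ∷ []) → foldCodeᴾ-fun stepᴾ o c 1 x }))
  where
  stepᴾ : Prog 3
  stepᴾ = andᴾ π₁ (isZeroᴾ (eqᴾ π₀ π₂))

absent-zero : ∀ x l → foldl (flip (absentStep x)) 0 l ≡ 0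
absent-zero x []      = refl
absent-zero x (y ∷ l) = absent-zero x l

absent-sound : ∀ h x k → absentℕ x (code (revPrefix h k)) ≢ 0 → ∀ i → i < k → h i ≢ x
absent-sound h x k nz = go k 1 (subst (_≢ 0) (foldCode-code (absentStep x) (revPrefix h k) 1) nz)
  where
  go : ∀ k a → foldl (flip (absentStep x)) a (revPrefix h k) ≢ 0 → ∀ i → i < k → h i ≢ x
  go (suc k) a nz i (s≤s i≤k) hi≡x with m≤n⇒m<n∨m≡n i≤k
  ... | inj₁ i<k  = go k _ nz i i<k hi≡x
  ... | inj₂ refl = proj₂ (andℕ≢0⇒ {a} acc≢0) (cong isZero (subst (λ y → eqℕ y x ≡ 1) (sym hi≡x) (eqℕ-refl x)))
    where
    acc≢0 : absentStep x (h i) a ≢ 0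
    acc≢0 acc≡0 = nz (trans (cong (λ acc → foldl (flip (absentStep x)) acc (revPrefix h i)) acc≡0)
                            (absent-zero x (revPrefix h i)))

absent-complete : ∀ h x k → (∀ i → i < k → h i ≢ x) → absentℕ x (code (revPrefix h k)) ≡ 1
absent-complete h x k fresh = trans (foldCode-code (absentStep x) (revPrefix h k) 1) (go k fresh)
  where
  go : ∀ k → (∀ i → i < k → h i ≢ x) → foldl (flip (absentStep x)) 1 (revPrefix h k) ≡ 1
  go zero    _     = refl
  go (suc k) fresh rewrite ≢⇒eqℕ≡0 (fresh k ≤-refl) = go k (λ i i<k → fresh i (m≤n⇒m≤1+n i<k))

edgeℕ : Baire → ℕ → ℕ → ℕ
edgeℕ p a b = eqℕ (p (pair a b)) 1

edgeℕ-sound : ∀ p a b → edgeℕ p a b ≢ 0 → Edge p a b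
edgeℕ-sound p a b nz = eqℕ≢0⇒≡ nz

edgeℕ-complete : ∀ p a b → Edge p a b → edgeℕ p a b ≡ 1
edgeℕ-complete p a b e rewrite e = refl

-- What the entry x at index j of an embedding of L_n must satisfy, the vertices
-- being listed as v₀, c₀, …, c_{n+1}, v₁, v₂, …: the previous entry prev must be
-- adjacent to x, except that v₁ hangs off v₀ = first, and c_{n+1} also closes
-- the cycle at v₀.
stepOKℕ : Baire → ℕ → ℕ → ℕ → ℕ → ℕ → ℕ
stepOKℕ p n j x prev first =
  ifZero j 1 (ifZero (leℕ j (suc n))
               (ifZero (eqℕ j (2 + n))
                  (ifZero (eqℕ j (3 + n)) (edgeℕ p prev x) (edgeℕ p first x))
                  (andℕ (edgeℕ p prev x) (edgeℕ p x first)))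
               (edgeℕ p prev x))

module _ (p : Baire) (n x prev first : ℕ) where

  stepOK-cycle : ∀ j → j ≤ n → stepOKℕ p n (suc j) x prev first ≡ edgeℕ p prev x
  stepOK-cycle j j≤n rewrite ≤⇒leℕ≡1 (s≤s j≤n) = refl

  stepOK-cycleEnd : stepOKℕ p n (2 + n) x prev first ≡ andℕ (edgeℕ p prev x) (edgeℕ p x first)
  stepOK-cycleEnd rewrite >⇒leℕ≡0 {2 + n} {suc n} ≤-refl | eqℕ-refl n = refl

  stepOK-rayStart : stepOKℕ p n (3 + n) x prev first ≡ edgeℕ p first x
  stepOK-rayStart
    rewrite >⇒leℕ≡0 {3 + n} {suc n} (s≤s (s≤s (n≤1+n n)))
          | ≢⇒eqℕ≡0 {3 + n} {2 + n} (λ eq → <-irrefl (sym eq) ≤-refl) | eqℕ-refl n = refl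

  stepOK-ray : ∀ i → stepOKℕ p n (4 + (i + n)) x prev first ≡ edgeℕ p prev x
  stepOK-ray i
    rewrite >⇒leℕ≡0 {4 + (i + n)} {suc n} (s≤s (s≤s (≤-trans (m≤n+m n i) (≤-trans (n≤1+n _) (n≤1+n _)))))
          | ≢⇒eqℕ≡0 {4 + (i + n)} {2 + n}
              (λ eq → <-irrefl (sym eq) (s≤s (s≤s (s≤s (≤-trans (m≤n+m n i) (n≤1+n _))))))
          | ≢⇒eqℕ≡0 {4 + (i + n)} {3 + n} (λ eq → <-irrefl (sym eq) (s≤s (s≤s (s≤s (s≤s (m≤n+m n i)))))) = refl

state : ℕ → ℕ → ℕ → ℕ → ℕ
state ok revPrefixCode len first = pair ok (pair revPrefixCode (pair len first))

stateOK stateRevPrefix stateLength stateFirst : ℕ → ℕ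
stateOK st        = pair₁ st
stateRevPrefix st = pair₁ (pair₂ st)
stateLength st    = pair₁ (pair₂ (pair₂ st))
stateFirst st     = pair₂ (pair₂ (pair₂ st))

-- A state records whether the sequence read so far is an initial segment of an
-- embedding, together with the code of its reverse, its length and its first entry.
extendOK : Baire → ℕ → ℕ → ℕ → ℕ
extendOK p n x st = andℕ (stateOK st) (andℕ (absentℕ x (stateRevPrefix st))
  (stepOKℕ p n (stateLength st) x (pair₁ (pred (stateRevPrefix st))) (stateFirst st)))

extendState : Baire → ℕ → ℕ → ℕ → ℕ
extendState p n x st =
  state (extendOK p n x st) (suc (pair x (stateRevPrefix st))) (suc (stateLength st)) (ifZero (stateLength st) x (stateFirst st))

initialState : ℕ
initialState = state 1 0 0 0

admissibleℕ : Baire → ℕ → ℕ → ℕ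
admissibleℕ p n c = isNonzero (stateOK (foldCode (extendState p n) c initialState))

graphTree : Baire → Baire
graphTree p k = admissibleℕ p (pair₁ k) (pair₂ k)

graphTreeProg : Prog 1
graphTreeProg = compP admissibleProg (pair₁ᴾ π₀ ∷ pair₂ᴾ π₀ ∷ [])
  where
  edgeᴾ : ∀ {k} → Prog k → Prog k → Prog k
  edgeᴾ a b = eqᴾ (app₁ oracleP (pairᴾ a b)) (constᴾ 1)
  extendStateᴾ : Prog 3
  extendStateᴾ = pairᴾ (andᴾ (pair₁ᴾ st) (andᴾ (absentᴾ x prefix) stepOK))
                       (pairᴾ (sucᴾ (pairᴾ x prefix)) (pairᴾ (sucᴾ j) (ifZeroᴾ j x first)))
    where
    x st n prefix j first prev stepOK : Prog 3
    x      = π₀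
    st     = π₁
    n      = π₂
    prefix = pair₁ᴾ (pair₂ᴾ st)
    j      = pair₁ᴾ (pair₂ᴾ (pair₂ᴾ st))
    first  = pair₂ᴾ (pair₂ᴾ (pair₂ᴾ st))
    prev   = pair₁ᴾ (predᴾ prefix)
    stepOK = ifZeroᴾ j (constᴾ 1) (ifZeroᴾ (leᴾ j (sucᴾ n))
               (ifZeroᴾ (eqᴾ j (sucᴾ (sucᴾ n)))
                  (ifZeroᴾ (eqᴾ j (sucᴾ (sucᴾ (sucᴾ n)))) (edgeᴾ prev x) (edgeᴾ first x))
                  (andᴾ (edgeᴾ prev x) (edgeᴾ x first)))
               (edgeᴾ prev x))
  admissibleProg : Prog 2
  admissibleProg =
    withFun (isZeroᴾ (isZeroᴾ (pair₁ᴾ (compP (foldCodeᴾ extendStateᴾ) (π₁ ∷ constᴾ initialState ∷ π₀ ∷ [])))))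
            (λ o → binary (admissibleℕ o))
            (λ { o (n ∷ c ∷ []) →
                 cong (λ st → isNonzero (stateOK st)) (foldCodeᴾ-fun extendStateᴾ o c initialState n) })

graphTreeProg-computes : ∀ p → Computes (term graphTreeProg) p (graphTree p)
graphTreeProg-computes = computes graphTreeProg

stateAfter : Baire → ℕ → List ℕ → ℕ
stateAfter p n σ = foldl (flip (extendState p n)) initialState σ

stateAfter-∷ʳ : ∀ p n σ x → stateAfter p n (σ ∷ʳ x) ≡ extendState p n x (stateAfter p n σ)
stateAfter-∷ʳ p n σ x = foldl-∷ʳ (flip (extendState p n)) initialState x σ

inGraphTree⇒ok : ∀ {p n σ} → InTree (graphTree p) n σ → isNonzero (stateOK (stateAfter p n σ)) ≡ 1
inGraphTree⇒ok {p} {n} {σ} inTree rewrite pair₁-pair n (code σ) | pair₂-pair n (code σ) =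
  trans (sym (cong (λ st → isNonzero (stateOK st)) (foldCode-code (extendState p n) σ initialState))) inTree

ok⇒inGraphTree : ∀ {p n σ} → isNonzero (stateOK (stateAfter p n σ)) ≡ 1 → InTree (graphTree p) n σ
ok⇒inGraphTree {p} {n} {σ} ok rewrite pair₁-pair n (code σ) | pair₂-pair n (code σ) =
  trans (cong (λ st → isNonzero (stateOK st)) (foldCode-code (extendState p n) σ initialState)) ok

stateOK-extendState : ∀ p n x st → stateOK (extendState p n x st) ≡ extendOK p n x st
stateOK-extendState p n x st = pair₁-pair (extendOK p n x st) _

stateTail-extendState : ∀ p n x st → pair₂ (extendState p n x st) ≡
  pair (suc (pair x (stateRevPrefix st))) (pair (suc (stateLength st)) (ifZero (stateLength st) x (stateFirst st)))
stateTail-extendState p n x st = pair₂-pair (extendOK p n x st) _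

graphTree-isTreeSeq : ∀ p → IsTreeSeq (graphTree p)
graphTree-isTreeSeq p =
  (λ k → isNonzero≤1 (stateOK (foldCode (extendState p (pair₁ k)) (pair₂ k) initialState))) , prefix-closed
  where
  prefix-closed : ∀ i σ x → InTree (graphTree p) i (σ ++ (x ∷ [])) → InTree (graphTree p) i σ
  prefix-closed i σ x inTree =
    ok⇒inGraphTree {p} {i} {σ} (≢0⇒isNonzero≡1 (proj₁ (andℕ≢0⇒ (subst (_≢ 0) (stateOK-extendState p i x _) ok≢0))))
    where
    ok≢0 : stateOK (extendState p i x (stateAfter p i σ)) ≢ 0
    ok≢0 = subst (_≢ 0) (cong stateOK (stateAfter-∷ʳ p i σ x))
             (isNonzero≢0⇒ (≡1⇒≢0 (inGraphTree⇒ok {p} {i} {σ ++ (x ∷ [])} inTree)))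

firstEntry : Baire → ℕ → ℕ
firstEntry h zero    = 0
firstEntry h (suc k) = h 0

module StatesAlong (p : Baire) (n : ℕ) (h : Baire) where

  stateAt : ℕ → ℕ
  stateAt k = stateAfter p n (map h (upTo k))

  stateAt-suc : ∀ k → stateAt (suc k) ≡ extendState p n (h k) (stateAt k)
  stateAt-suc k = trans (cong (stateAfter p n) prefix-∷ʳ) (stateAfter-∷ʳ p n (map h (upTo k)) (h k))
    where
    prefix-∷ʳ : map h (upTo (suc k)) ≡ map h (upTo k) ∷ʳ h k
    prefix-∷ʳ = trans (cong (map h) (sym (upTo-∷ʳ k))) (map-++ h (upTo k) (k ∷ []))

  stateAt-tail : ∀ k → pair₂ (stateAt k) ≡ pair (code (revPrefix h k)) (pair k (firstEntry h k))
  stateAt-tail zero = pair₂-pair 1 (pair 0 (pair 0 0))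
  stateAt-tail (suc k)
    rewrite stateAt-suc k | stateTail-extendState p n (h k) (stateAt k) | stateAt-tail k
          | pair₁-pair (code (revPrefix h k)) (pair k (firstEntry h k))
          | pair₂-pair (code (revPrefix h k)) (pair k (firstEntry h k))
          | pair₁-pair k (firstEntry h k) | pair₂-pair k (firstEntry h k) =
    cong (λ w → pair (code (revPrefix h (suc k))) (pair (suc k) w)) (first k)
    where
    first : ∀ k → ifZero k (h k) (firstEntry h k) ≡ firstEntry h (suc k)
    first zero    = refl
    first (suc k) = refl

  previous : ℕ → ℕ
  previous k = pair₁ (pred (code (revPrefix h k)))

  previous-suc : ∀ k → previous (suc k) ≡ h k
  previous-suc k = pair₁-pair (h k) (code (revPrefix h k))

  stateAt-ok : ∀ k → stateOK (stateAt (suc k)) ≡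
    andℕ (stateOK (stateAt k))
         (andℕ (absentℕ (h k) (code (revPrefix h k))) (stepOKℕ p n k (h k) (previous k) (firstEntry h k)))
  stateAt-ok k
    rewrite stateAt-suc k | stateOK-extendState p n (h k) (stateAt k) | stateAt-tail k
          | pair₁-pair (code (revPrefix h k)) (pair k (firstEntry h k))
          | pair₂-pair (code (revPrefix h k)) (pair k (firstEntry h k))
          | pair₁-pair k (firstEntry h k) | pair₂-pair k (firstEntry h k) = refl

module ListOrder (n : ℕ) where

  listIndex : LV n → ℕ
  listIndex (inj₁ zero)    = 0
  listIndex (inj₁ (suc i)) = 3 + (i + n)
  listIndex (inj₂ j)       = suc (toℕ j)

  listVertex : ℕ → LV n
  listVertex zero = inj₁ 0
  listVertex (suc k) with k <? 2 + n
  ... | yes k< = inj₂ (fromℕ< k<)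
  ... | no  _  = inj₁ (k ∸ suc n)

  listVertex-cycle : ∀ k (k< : k < 2 + n) → listVertex (suc k) ≡ inj₂ (fromℕ< k<)
  listVertex-cycle k k< with k <? 2 + n
  ... | yes _  = refl
  ... | no  k≮ = ⊥-elim (k≮ k<)

  listVertex-ray : ∀ i → listVertex (3 + (i + n)) ≡ inj₁ (suc i)
  listVertex-ray i with 2 + (i + n) <? 2 + n
  ... | yes i+n< = ⊥-elim (<-irrefl refl (≤-trans (s≤s (s≤s (s≤s (m≤n+m n i)))) i+n<))
  ... | no  _    = cong inj₁ (m+n∸n≡m (suc i) n)

  listIndex-listVertex : ∀ k → listIndex (listVertex k) ≡ k
  listIndex-listVertex zero = refl
  listIndex-listVertex (suc k) with k <? 2 + n
  ... | yes k< = cong suc (toℕ-fromℕ< k<)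
  ... | no  k≮ with k ∸ suc n in eq
  ...   | zero  = ⊥-elim (<-irrefl refl (≤-trans (≮⇒≥ k≮) (m∸n≡0⇒m≤n eq)))
  ...   | suc t = cong suc (trans (cong suc (sym (+-suc t n))) t+2+n≡k)
    where
    t+2+n≡k : suc t + suc n ≡ k
    t+2+n≡k = trans (cong (_+ suc n) (sym eq)) (m∸n+n≡m (≤-trans (n≤1+n _) (≮⇒≥ k≮)))

  listVertex-injective : ∀ i j → listVertex i ≡ listVertex j → i ≡ j
  listVertex-injective i j eq = begin
    i                        ≡⟨ listIndex-listVertex i ⟨
    listIndex (listVertex i) ≡⟨ cong listIndex eq ⟩
    listIndex (listVertex j) ≡⟨ listIndex-listVertex j ⟩
    j                        ∎
    where open ≡-Reasoning

  private
    ray≢cycle : ∀ i (j : Fin (2 + n)) → 2 + (i + n) ≢ toℕ j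
    ray≢cycle i j eq = <-irrefl refl (≤-trans (s≤s (s≤s (s≤s (m≤n+m n i)))) (subst (_< 2 + n) (sym eq) (toℕ<n j)))

  listIndex-injective : ∀ a b → listIndex a ≡ listIndex b → a ≡ b
  listIndex-injective (inj₁ zero)    (inj₁ zero)    _  = refl
  listIndex-injective (inj₁ (suc i)) (inj₁ (suc j)) eq =
    cong (λ k → inj₁ (suc k)) (+-cancelʳ-≡ n i j (suc-injective (suc-injective (suc-injective eq))))
  listIndex-injective (inj₁ (suc i)) (inj₂ j)       eq = ⊥-elim (ray≢cycle i j (suc-injective eq))
  listIndex-injective (inj₂ i)       (inj₁ (suc j)) eq = ⊥-elim (ray≢cycle j i (sym (suc-injective eq)))
  listIndex-injective (inj₂ i)       (inj₂ j)       eq = cong inj₂ (toℕ-injective (suc-injective eq))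
  listIndex-injective (inj₁ zero)    (inj₁ (suc j)) ()
  listIndex-injective (inj₁ zero)    (inj₂ j)       ()
  listIndex-injective (inj₁ (suc i)) (inj₁ zero)    ()
  listIndex-injective (inj₂ i)       (inj₁ zero)    ()

  data ListRange : ℕ → Set where
    at-first    : ListRange 0
    at-cycle    : ∀ j → j ≤ n → ListRange (suc j)
    at-cycleEnd : ListRange (2 + n)
    at-rayStart : ListRange (3 + n)
    at-ray      : ∀ i → ListRange (4 + (i + n))

  listRange : ∀ k → ListRange k
  listRange zero = at-first
  listRange (suc k) with k ≤? n
  ... | yes k≤n = at-cycle k k≤n
  ... | no  k≰n with k ≟ suc n
  ...   | yes refl = at-cycleEnd
  ...   | no  k≢1+n with k ≟ 2 + n
  ...     | yes refl = at-rayStart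
  ...     | no  k≢2+n = subst ListRange (cong suc k≡) (at-ray (k ∸ (3 + n)))
    where
    3+n≤k : 3 + n ≤ k
    3+n≤k = ≤∧≢⇒< (≤∧≢⇒< (≰⇒> k≰n) (λ eq → k≢1+n (sym eq))) (λ eq → k≢2+n (sym eq))
    k≡ : 3 + (k ∸ (3 + n) + n) ≡ k
    k≡ = trans (sym (trans (+-suc t (2 + n)) (cong suc (trans (+-suc t (1 + n)) (cong suc (+-suc t n))))))
               (m∸n+n≡m 3+n≤k)
      where
      t : ℕ
      t = k ∸ (3 + n)

module PathInGraphTree (p : Baire) (n : ℕ) (h : Baire) (onPath : ∀ k → InTree (graphTree p) n (map h (upTo k))) where
  open StatesAlong p n h
  open ListOrder n

  step-conditions : ∀ k → absentℕ (h k) (code (revPrefix h k)) ≢ 0 ×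
                          stepOKℕ p n k (h k) (previous k) (firstEntry h k) ≢ 0
  step-conditions k = andℕ≢0⇒ (proj₂ (andℕ≢0⇒ {stateOK (stateAt k)} (subst (_≢ 0) (stateAt-ok k) ok≢0)))
    where
    ok≢0 : stateOK (stateAt (suc k)) ≢ 0
    ok≢0 = isNonzero≢0⇒ (≡1⇒≢0 (inGraphTree⇒ok {p} {n} {map h (upTo (suc k))} (onPath (suc k))))

  h-injective : ∀ i j → h i ≡ h j → i ≡ j
  h-injective i j eq with <-cmp i j
  ... | tri< i<j _ _ = ⊥-elim (absent-sound h (h j) j (proj₁ (step-conditions j)) i i<j eq)
  ... | tri≈ _ i≡j _ = i≡j
  ... | tri> _ _ j<i = ⊥-elim (absent-sound h (h i) i (proj₁ (step-conditions i)) j j<i (sym eq))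

  stepOK≢0 : ∀ k → stepOKℕ p n k (h k) (previous k) (firstEntry h k) ≢ 0
  stepOK≢0 k = proj₂ (step-conditions k)

  edge-from-previous : ∀ j → edgeℕ p (previous (suc j)) (h (suc j)) ≢ 0 → Edge p (h j) (h (suc j))
  edge-from-previous j nz = subst (λ x → Edge p x (h (suc j))) (previous-suc j) (edgeℕ-sound p (previous (suc j)) (h (suc j)) nz)

  edge-cycle : ∀ j → j ≤ n → Edge p (h j) (h (suc j))
  edge-cycle j j≤n = edge-from-previous j
    (subst (_≢ 0) (stepOK-cycle p n (h (suc j)) (previous (suc j)) (h 0) j j≤n) (stepOK≢0 (suc j)))

  edge-cycleEnd : Edge p (h (suc n)) (h (2 + n)) × Edge p (h (2 + n)) (h 0)
  edge-cycleEnd with andℕ≢0⇒ (subst (_≢ 0) (stepOK-cycleEnd p n (h (2 + n)) (previous (2 + n)) (h 0)) (stepOK≢0 (2 + n)))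
  ... | into , out = edge-from-previous (suc n) into , edgeℕ-sound p (h (2 + n)) (h 0) out

  edge-rayStart : Edge p (h 0) (h (3 + n))
  edge-rayStart = edgeℕ-sound p (h 0) (h (3 + n))
    (subst (_≢ 0) (stepOK-rayStart p n (h (3 + n)) (previous (3 + n)) (h 0)) (stepOK≢0 (3 + n)))

  edge-ray : ∀ i → Edge p (h (3 + (i + n))) (h (4 + (i + n)))
  edge-ray i = edge-from-previous (3 + (i + n))
    (subst (_≢ 0) (stepOK-ray p n (h (4 + (i + n))) (previous (4 + (i + n))) (h 0) i) (stepOK≢0 (4 + (i + n))))

  embedding : SubgraphL n p
  embedding = (λ a → h (listIndex a)) , (λ {a} {b} eq → listIndex-injective a b (h-injective _ _ eq)) , edges
    where
    edges : ∀ a b → LE n a b → Edge p (h (listIndex a)) (h (listIndex b))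
    edges _ _ (path zero)    = edge-rayStart
    edges _ _ (path (suc i)) = edge-ray i
    edges _ _ cycStart       = edge-cycle 0 z≤n
    edges _ _ (cyc j) rewrite toℕ-inject₁ j with m≤n⇒m<n∨m≡n (≤-pred (toℕ<n j))
    ... | inj₁ j<n+1 = edge-cycle (suc (toℕ j)) j<n+1
    ... | inj₂ j≡n rewrite j≡n = proj₁ edge-cycleEnd
    edges _ _ cycEnd rewrite toℕ-fromℕ n = proj₂ edge-cycleEnd

module EmbeddingToPath (p : Baire) (n : ℕ) (f : LV n → ℕ) (f-injective : Injective _≡_ _≡_ f)
                       (f-edge : ∀ a b → LE n a b → Edge p (f a) (f b)) where
  open ListOrder n

  h : Baire
  h k = f (listVertex k)

  open StatesAlong p n h

  h-distinct : ∀ i k → i < k → h i ≢ h k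
  h-distinct i k i<k eq = <-irrefl (listVertex-injective i k (f-injective eq)) i<k

  edge : ∀ {a b a′ b′} → LE n a b → a′ ≡ a → b′ ≡ b → Edge p (f a′) (f b′)
  edge l refl refl = f-edge _ _ l

  edge-gadgets : ∀ j → j < suc n → Edge p (h (suc j)) (h (2 + j))
  edge-gadgets j j< = edge (cyc (fromℕ< j<))
    (trans (listVertex-cycle j (m≤n⇒m≤1+n j<)) (cong inj₂ (sym (inject₁-fromℕ< j< (m≤n⇒m≤1+n j<)))))
    (listVertex-cycle (suc j) (s≤s j<))

  edge-cycle : ∀ j → j ≤ n → Edge p (h j) (h (suc j))
  edge-cycle zero    _  = edge cycStart refl (listVertex-cycle 0 (s≤s z≤n))
  edge-cycle (suc j) j< = edge-gadgets j (m≤n⇒m≤1+n j<)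

  edge-cycleEnd : Edge p (h (2 + n)) (h 0)
  edge-cycleEnd = edge cycEnd (trans (listVertex-cycle (suc n) ≤-refl) (cong inj₂ (sym (fromℕ≡fromℕ< ≤-refl)))) refl

  complete-from-previous : ∀ j → Edge p (h j) (h (suc j)) → edgeℕ p (previous (suc j)) (h (suc j)) ≡ 1
  complete-from-previous j e =
    edgeℕ-complete p (previous (suc j)) (h (suc j)) (subst (λ x → Edge p x (h (suc j))) (sym (previous-suc j)) e)

  stepOK-holds : ∀ k → stepOKℕ p n k (h k) (previous k) (firstEntry h k) ≡ 1
  stepOK-holds k with listRange k
  ... | at-first = refl
  ... | at-cycle j j≤n =
    trans (stepOK-cycle p n (h (suc j)) (previous (suc j)) (h 0) j j≤n) (complete-from-previous j (edge-cycle j j≤n))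
  ... | at-cycleEnd =
    trans (stepOK-cycleEnd p n (h (2 + n)) (previous (2 + n)) (h 0))
          (cong₂ andℕ (complete-from-previous (suc n) (edge-gadgets n ≤-refl))
                      (edgeℕ-complete p (h (2 + n)) (h 0) edge-cycleEnd))
  ... | at-rayStart =
    trans (stepOK-rayStart p n (h (3 + n)) (previous (3 + n)) (h 0))
          (edgeℕ-complete p (h 0) (h (3 + n)) (edge (path 0) refl (listVertex-ray 0)))
  ... | at-ray i =
    trans (stepOK-ray p n (h (4 + (i + n))) (previous (4 + (i + n))) (h 0) i)
          (complete-from-previous (3 + (i + n)) (edge (path (suc i)) (listVertex-ray i) (listVertex-ray (suc i))))

  stateAt-ok≡1 : ∀ k → stateOK (stateAt k) ≡ 1
  stateAt-ok≡1 zero = pair₁-pair 1 (pair 0 (pair 0 0))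
  stateAt-ok≡1 (suc k)
    rewrite stateAt-ok k | stateAt-ok≡1 k | absent-complete h (h k) k (λ i i<k → h-distinct i k i<k)
          | stepOK-holds k = refl

  hasPath : HasPath (graphTree p) n
  hasPath = h , λ k → ok⇒inGraphTree {p} {n} {map h (upTo k)} (cong isNonzero (stateAt-ok≡1 k))

graphTree-path⇒subgraph : ∀ p n → HasPath (graphTree p) n → SubgraphL n p
graphTree-path⇒subgraph p n (h , onPath) = PathInGraphTree.embedding p n h onPath

subgraph⇒graphTree-path : ∀ p n → SubgraphL n p → HasPath (graphTree p) n
subgraph⇒graphTree-path p n (f , f-injective , f-edge) = EmbeddingToPath.hasPath p n f f-injective f-edge

complementProg : Prog 1
complementProg = constᴾ 1 ∸ᴾ app₁ oracleP π₀

flip-answer₁ : ∀ {A B : Set} {x} → (A → B) → (B → A) →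
               (x ≡ 1 × A) ⊎ (x ≡ 0 × ¬ A) → (1 ∸ x ≡ 0 × B) ⊎ (1 ∸ x ≡ 1 × ¬ B)
flip-answer₁ to from (inj₁ (refl , a))  = inj₁ (refl , to a)
flip-answer₁ to from (inj₂ (refl , ¬a)) = inj₂ (refl , λ b → ¬a (from b))

flip-answer₀ : ∀ {A B : Set} {x} → (A → B) → (B → A) →
               (x ≡ 0 × A) ⊎ (x ≡ 1 × ¬ A) → (1 ∸ x ≡ 1 × B) ⊎ (1 ∸ x ≡ 0 × ¬ B)
flip-answer₀ to from (inj₁ (refl , a))  = inj₁ (refl , to a)
flip-answer₀ to from (inj₂ (refl , ¬a)) = inj₂ (refl , λ b → ¬a (from b))

WFhat≤sWSL : WFhat ≤sW SL
WFhat≤sWSL = term treeGraphProg , term complementProg , λ p trees →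
  treeGraph p , treeGraphProg-computes p , treeGraph-isGraph p , λ s answers →
  (λ i → 1 ∸ s i) , computes complementProg s ,
  λ i → flip-answer₁ (subgraph⇒path p i trees) (path⇒subgraph p i) (answers i)

SL≤sWWFhat : SL ≤sW WFhat
SL≤sWWFhat = term graphTreeProg , term complementProg , λ p _ →
  graphTree p , graphTreeProg-computes p , graphTree-isTreeSeq p , λ w answers →
  (λ i → 1 ∸ w i) , computes complementProg w ,
  λ i → flip-answer₀ (graphTree-path⇒subgraph p i) (subgraph⇒graphTree-path p i) (answers i)

theorem27 : WFhat ≡sW SL
theorem27 = WFhat≤sWSL , SL≤sWWFhat
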